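{- For a finite simple graph $G$, the following assertions are equivalent: (i) $G$ is a König–Egerváry graph; (ii) every non-empty family of maximum critical independent sets of $G$ is a König–Egerváry collection; (iii) there is a (non-empty) König–Egerváry collection of maximum critical independent sets of $G$.
   Context: For a graph $G$ and $A\subseteq V(G)$: $N(A)=\{v\in V(G): v \text{ has a neighbor in } A\}$. A set is independent if no two of its vertices are adjacent; $\mathrm{Ind}(G)$ is the family of independent sets and $\alpha(G)$ the maximum size of an independent set. $\mu(G)$ is the maximum cardinality of a matching. $G$ is a König–Egerváry graph if $\alpha(G)+\mu(G)=|V(G)|$. The difference of $X\subseteq V(G)$ is $d(X)=|X|-|N(X)|$. An independent set $A$ is critical if $d(A)=\max\{d(I):I\in\mathrm{Ind}(G)\}$. A maximum critical independent set is a critical independent set of maximum cardinality among all critical independent sets. A non-empty family $\Gamma$ of independent sets of $G$ is a König–Egerváry collection if $\left|\bigcap\Gamma\right|+\left|\bigcup\Gamma\right|=2\alpha(G)$. -}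

module Defs where

open import Data.Nat using (ℕ; _+_; _*_; _≤_)
open import Data.Integer as ℤ using (ℤ; +_; _-_)
open import Data.Bool using (Bool; true; false; _∧_; _∨_)
open import Data.Fin using (Fin)
open import Data.Fin.Subset using (Subset; _∈_; ∣_∣; ⋃; ⋂; inside; outside)
open import Data.Vec using (Vec; tabulate; lookup; foldr)
open import Data.List using (List; length; concatMap; _∷_; [])
open import Data.List.NonEmpty using (List⁺; toList)
open import Data.List.Relation.Unary.All using (All)
open import Data.List.Relation.Unary.Unique.Propositional using (Unique)
open import Data.Product using (Σ; _×_; _,_; ∃)
open import Relation.Binary.PropositionalEquality using (_≡_)

record Graph (n : ℕ) : Set where
  field
    adj   : Fin n → Fin n → Bool
    sym   : ∀ u v → adj u v ≡ adj v u
    irrefl : ∀ v → adj v v ≡ false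
open Graph public

module _ {n : ℕ} (G : Graph n) where

  Independent : Subset n → Set
  Independent A = ∀ u v → u ∈ A → v ∈ A → adj G u v ≡ false

  anyFin : (Fin n → Bool) → Bool
  anyFin p = foldr (λ _ → Bool) _∨_ false (tabulate p)

  N : Subset n → Subset n
  N A = tabulate (λ v → anyFin (λ u → lookup A u ∧ adj G v u))

  d : Subset n → ℤ
  d X = (+ ∣ X ∣) - (+ ∣ N X ∣)

  IsAlpha : ℕ → Set
  IsAlpha a = (Σ (Subset n) λ S → Independent S × ∣ S ∣ ≡ a)
            × (∀ S → Independent S → ∣ S ∣ ≤ a)

  endpoints : List (Fin n × Fin n) → List (Fin n)
  endpoints = concatMap (λ { (u , v) → u ∷ v ∷ [] })

  IsMatching : List (Fin n × Fin n) → Set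
  IsMatching M = All (λ { (u , v) → adj G u v ≡ true }) M × Unique (endpoints M)

  IsMu : ℕ → Set
  IsMu m = (Σ (List (Fin n × Fin n)) λ M → IsMatching M × length M ≡ m)
         × (∀ M → IsMatching M → length M ≤ m)

  IsKE : Set
  IsKE = ∃ λ a → ∃ λ m → IsAlpha a × IsMu m × a + m ≡ n

  IsCritical : Subset n → Set
  IsCritical A = Independent A × (∀ I → Independent I → d I ℤ.≤ d A)

  IsMaxCritical : Subset n → Set
  IsMaxCritical A = IsCritical A × (∀ B → IsCritical B → ∣ B ∣ ≤ ∣ A ∣)

  IsKECollection : List⁺ (Subset n) → Set
  IsKECollection Γ = All Independent (toList Γ)
    × ∃ λ a → IsAlpha a × ∣ ⋂ (toList Γ) ∣ + ∣ ⋃ (toList Γ) ∣ ≡ 2 * a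

module Submission where

-- For a graph it then
-- shows: d is supermodular, so every critical set lies in A ∪ N(A) for a
-- maximum critical A; Larson's lemma gives Hall's condition for N(A) into A
-- for critical A; Hall's theorem itself; and for a matching M with partner
-- involution on its vertex set V, weak duality μ ≤ n − α and the structure of
-- an independent S with ∣S∣ + ∣M∣ = n (S ⊇ V's complement and contains one end
-- of each edge).  (i) ⇒ (ii): maximum critical sets of a KE graph are maximum
-- independent, and families of those are KE collections.  (iii) ⇒ (i): a KE
-- collection of maximum critical sets forces each member A to have size α, and
-- then Hall matches N(A) = V ─ A into A.  (ii) ⇒ (iii) needs only the
-- existence of a maximum critical set.

open import Defs renaming (sym to adj-sym)
open import Data.Nat using (ℕ; zero; suc; _+_; _*_; _≤_; _<_; z≤n; s≤s; s≤s⁻¹; _≤?_; _<?_)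
open import Data.Nat.Properties
open import Data.Nat.Tactic.RingSolver using (solve-∀)
open import Data.Integer as ℤ using (ℤ)
import Data.Integer.Properties as ℤP
import Data.Integer.Tactic.RingSolver as ℤSolver
open import Data.Bool using (Bool; true; false; _∧_; _∨_) renaming (_≟_ to _≟ᵇ_)
open import Data.Vec using ([]; _∷_; lookup; tabulate; foldr)
import Data.Vec as Vec
open import Data.Vec.Properties using ([]=⇒lookup; lookup⇒[]=; lookup∘tabulate)
open import Data.Fin using (Fin; zero; suc) renaming (_≟_ to _≟ᶠ_)
open import Data.Fin.Properties using (all?) renaming (suc-injective to Fin-suc-injective)
open import Data.Fin.Subset
  using (Subset; inside; outside; _∈_; _∉_; _⊆_; _∪_; _∩_; _─_; _-_; ∁; ⁅_⁆; ∣_∣; ⋃; ⋂; Nonempty)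
  renaming (⊥ to ∅)
open import Data.Fin.Subset.Properties
open import Data.List using (List; []; _∷_; _++_; map; length)
open import Data.List.Properties using (length-map)
open import Data.List.Membership.Propositional using () renaming (_∈_ to _∈ˡ_)
open import Data.List.Membership.Propositional.Properties using (∈-map⁺; ∈-map⁻; ∈-++⁺ˡ; ∈-++⁺ʳ)
open import Data.List.Relation.Unary.Any using (here; there)
open import Data.List.Relation.Unary.All as All using (All; []; _∷_)
open import Data.List.Relation.Unary.Unique.Propositional using (Unique)
open import Data.List.Relation.Unary.AllPairs using ([]; _∷_)
open import Data.List.NonEmpty using (List⁺; toList) renaming (_∷_ to _∷⁺_)
open import Data.Product using (Σ; _×_; _,_; ∃; proj₁; proj₂)
open import Data.Sum using (_⊎_; inj₁; inj₂; [_,_]′)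
open import Data.Empty using (⊥-elim)
open import Function using (_∘_)
open import Relation.Nullary using (¬_; Dec; yes; no)
open import Relation.Nullary.Decidable using (_→-dec_; _×-dec_)
open import Function.Bundles using (_⇔_; mk⇔; Equivalence)
open import Relation.Binary.PropositionalEquality

private variable
  n : ℕ

∣p∪q∣+∣p∩q∣≡∣p∣+∣q∣ : (p q : Subset n) → ∣ p ∪ q ∣ + ∣ p ∩ q ∣ ≡ ∣ p ∣ + ∣ q ∣
∣p∪q∣+∣p∩q∣≡∣p∣+∣q∣ [] [] = refl
∣p∪q∣+∣p∩q∣≡∣p∣+∣q∣ (inside ∷ p) (inside ∷ q) = cong suc (begin
  ∣ p ∪ q ∣ + suc ∣ p ∩ q ∣    ≡⟨ +-suc ∣ p ∪ q ∣ ∣ p ∩ q ∣ ⟩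
  suc (∣ p ∪ q ∣ + ∣ p ∩ q ∣)  ≡⟨ cong suc (∣p∪q∣+∣p∩q∣≡∣p∣+∣q∣ p q) ⟩
  suc (∣ p ∣ + ∣ q ∣)          ≡⟨ +-suc ∣ p ∣ ∣ q ∣ ⟨
  ∣ p ∣ + suc ∣ q ∣            ∎)
  where open ≡-Reasoning
∣p∪q∣+∣p∩q∣≡∣p∣+∣q∣ (inside ∷ p) (outside ∷ q) = cong suc (∣p∪q∣+∣p∩q∣≡∣p∣+∣q∣ p q)
∣p∪q∣+∣p∩q∣≡∣p∣+∣q∣ (outside ∷ p) (inside ∷ q) =
  trans (cong suc (∣p∪q∣+∣p∩q∣≡∣p∣+∣q∣ p q)) (sym (+-suc ∣ p ∣ ∣ q ∣))
∣p∪q∣+∣p∩q∣≡∣p∣+∣q∣ (outside ∷ p) (outside ∷ q) = ∣p∪q∣+∣p∩q∣≡∣p∣+∣q∣ p q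

∣p∩q∣+∣p─q∣≡∣p∣ : (p q : Subset n) → ∣ p ∩ q ∣ + ∣ p ─ q ∣ ≡ ∣ p ∣
∣p∩q∣+∣p─q∣≡∣p∣ [] [] = refl
∣p∩q∣+∣p─q∣≡∣p∣ (inside ∷ p) (inside ∷ q) = cong suc (∣p∩q∣+∣p─q∣≡∣p∣ p q)
∣p∩q∣+∣p─q∣≡∣p∣ (inside ∷ p) (outside ∷ q) =
  trans (+-suc ∣ p ∩ q ∣ ∣ p ─ q ∣) (cong suc (∣p∩q∣+∣p─q∣≡∣p∣ p q))
∣p∩q∣+∣p─q∣≡∣p∣ (outside ∷ p) (inside ∷ q) = ∣p∩q∣+∣p─q∣≡∣p∣ p q
∣p∩q∣+∣p─q∣≡∣p∣ (outside ∷ p) (outside ∷ q) = ∣p∩q∣+∣p─q∣≡∣p∣ p q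

∣p∪q∣≤∣p∣+∣q∣ : (p q : Subset n) → ∣ p ∪ q ∣ ≤ ∣ p ∣ + ∣ q ∣
∣p∪q∣≤∣p∣+∣q∣ p q = ≤-trans (m≤m+n ∣ p ∪ q ∣ ∣ p ∩ q ∣) (≤-reflexive (∣p∪q∣+∣p∩q∣≡∣p∣+∣q∣ p q))

x∈p─q⇒x∉q : ∀ {x : Fin n} (p q : Subset n) → x ∈ p ─ q → x ∉ q
x∈p─q⇒x∉q (inside ∷ p) (outside ∷ q) Vec.here ()
x∈p─q⇒x∉q (_ ∷ p) (_ ∷ q) (Vec.there x∈) (Vec.there x∈q) = x∈p─q⇒x∉q p q x∈ x∈q

⊆-antisym-∣∣ : {p q : Subset n} → p ⊆ q → q ⊆ p → ∣ p ∣ ≡ ∣ q ∣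
⊆-antisym-∣∣ p⊆q q⊆p = cong ∣_∣ (⊆-antisym p⊆q q⊆p)

⊆-∉⇒∣∣< : {p q : Subset n} {x : Fin n} → p ⊆ q → x ∈ q → x ∉ p → ∣ p ∣ < ∣ q ∣
⊆-∉⇒∣∣< p⊆q x∈q x∉p = p⊂q⇒∣p∣<∣q∣ (p⊆q , _ , x∈q , x∉p)

empty-∣∣≡0 : (p : Subset n) → ¬ Nonempty p → ∣ p ∣ ≡ 0
empty-∣∣≡0 {n} p p-empty = trans (cong ∣_∣ (Empty-unique p-empty)) (∣⊥∣≡0 n)

nonempty-of-size : (p : Subset n) → 1 ≤ ∣ p ∣ → Nonempty p
nonempty-of-size p 1≤∣p∣ with nonempty? p
... | yes p-nonempty = p-nonempty
... | no p-empty = ⊥-elim (1+n≰n (subst (1 ≤_) (empty-∣∣≡0 p p-empty) 1≤∣p∣))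

Disjoint : Subset n → Subset n → Set
Disjoint p q = ∀ {x} → x ∈ p → x ∉ q

∣p∪q∣≡∣p∣+∣q∣ : (p q : Subset n) → Disjoint p q → ∣ p ∪ q ∣ ≡ ∣ p ∣ + ∣ q ∣
∣p∪q∣≡∣p∣+∣q∣ {n} p q disj = begin
  ∣ p ∪ q ∣              ≡⟨ +-identityʳ ∣ p ∪ q ∣ ⟨
  ∣ p ∪ q ∣ + 0          ≡⟨ cong (∣ p ∪ q ∣ +_) ∣p∩q∣≡0 ⟨
  ∣ p ∪ q ∣ + ∣ p ∩ q ∣  ≡⟨ ∣p∪q∣+∣p∩q∣≡∣p∣+∣q∣ p q ⟩
  ∣ p ∣ + ∣ q ∣          ∎
  where
  open ≡-Reasoning
  ∣p∩q∣≡0 : ∣ p ∩ q ∣ ≡ 0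
  ∣p∩q∣≡0 = trans (cong ∣_∣ (Empty-unique λ (x , x∈) → let (x∈p , x∈q) = x∈p∩q⁻ p q x∈ in disj x∈p x∈q))
                  (∣⊥∣≡0 n)

-- If p contains the complement of q, then p ─ q is exactly that complement.
∣p∩q∣+∣∁q∣≡∣p∣ : (p q : Subset n) → ∁ q ⊆ p → ∣ p ∩ q ∣ + ∣ ∁ q ∣ ≡ ∣ p ∣
∣p∩q∣+∣∁q∣≡∣p∣ p q ∁q⊆p = trans (cong (λ r → ∣ p ∩ q ∣ + ∣ r ∣) (⊆-antisym ∁q⊆p─q p─q⊆∁q)) (∣p∩q∣+∣p─q∣≡∣p∣ p q)
  where
  ∁q⊆p─q : ∁ q ⊆ p ─ q
  ∁q⊆p─q x∈ = x∈p∧x∉q⇒x∈p─q (∁q⊆p x∈) (x∈∁p⇒x∉p x∈)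
  p─q⊆∁q : p ─ q ⊆ ∁ q
  p─q⊆∁q x∈ = x∉p⇒x∈∁p (x∈p─q⇒x∉q p q x∈)

disjoint-≤ : (p q : Subset n) → Disjoint p q → ∣ p ∣ + ∣ q ∣ ≤ n
disjoint-≤ p q disj = subst (_≤ _) (∣p∪q∣≡∣p∣+∣q∣ p q disj) (∣p∣≤n (p ∪ q))

∣∁p∣+∣p∣≡n : (p : Subset n) → ∣ ∁ p ∣ + ∣ p ∣ ≡ n
∣∁p∣+∣p∣≡n p = trans (cong (_+ ∣ p ∣) (∣∁p∣≡n∸∣p∣ p)) (m∸n+n≡m (∣p∣≤n p))

map-unique : ∀ {A B : Set} (f : A → B) (xs : List A) → Unique xs →
             (∀ {x y} → x ∈ˡ xs → y ∈ˡ xs → f x ≡ f y → x ≡ y) → Unique (map f xs)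
map-unique f [] [] inj = []
map-unique f (x ∷ xs) (x∉xs ∷ u) inj =
  All.tabulate (λ fy∈ fx≡fy → let (y , y∈ , fy≡) = ∈-map⁻ f fy∈ in
    All.lookup x∉xs y∈ (inj (here refl) (there y∈) (trans fx≡fy fy≡)))
  ∷ map-unique f xs u (λ x∈ y∈ → inj (there x∈) (there y∈))

elems : Subset n → List (Fin n)
elems [] = []
elems (inside ∷ p) = zero ∷ map suc (elems p)
elems (outside ∷ p) = map suc (elems p)

elems-sound : {x : Fin n} (p : Subset n) → x ∈ˡ elems p → x ∈ p
elems-sound (inside ∷ p) (here refl) = Vec.here
elems-sound (inside ∷ p) (there x∈) with ∈-map⁻ suc x∈
... | _ , y∈ , refl = Vec.there (elems-sound p y∈)
elems-sound (outside ∷ p) x∈ with ∈-map⁻ suc x∈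
... | _ , y∈ , refl = Vec.there (elems-sound p y∈)

elems-length : (p : Subset n) → length (elems p) ≡ ∣ p ∣
elems-length [] = refl
elems-length (inside ∷ p) = cong suc (trans (length-map suc (elems p)) (elems-length p))
elems-length (outside ∷ p) = trans (length-map suc (elems p)) (elems-length p)

elems-unique : (p : Subset n) → Unique (elems p)
elems-unique [] = []
elems-unique (inside ∷ p) =
  All.tabulate (λ y∈ → let (_ , _ , y≡) = ∈-map⁻ suc y∈ in zero≢suc y≡)
  ∷ map-unique suc (elems p) (elems-unique p) (λ _ _ → Fin-suc-injective)
  where
  zero≢suc : ∀ {m} {x : Fin m} {y : Fin (suc m)} → y ≡ suc x → zero ≢ y
  zero≢suc refl ()
elems-unique (outside ∷ p) = map-unique suc (elems p) (elems-unique p) (λ _ _ → Fin-suc-injective)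

unique-length-≤ : (xs : List (Fin n)) (q : Subset n) → Unique xs → All (_∈ q) xs → length xs ≤ ∣ q ∣
unique-length-≤ [] q [] [] = z≤n
unique-length-≤ (x ∷ xs) q (x∉xs ∷ u) (x∈q ∷ xs⊆q) =
  ≤-trans (s≤s (unique-length-≤ xs (q - x) u (All.tabulate xs⊆q-x))) (x∈p⇒∣p-x∣<∣p∣ x∈q)
  where
  xs⊆q-x : ∀ {y} → y ∈ˡ xs → y ∈ q - x
  xs⊆q-x y∈ = x∈p∧x≢y⇒x∈p-y (All.lookup xs⊆q y∈) (λ y≡x → All.lookup x∉xs y∈ (sym y≡x))

injection-≤ : (f : Fin n → Fin n) (p q : Subset n) → (∀ {x} → x ∈ p → f x ∈ q) →
              (∀ {x y} → x ∈ p → y ∈ p → f x ≡ f y → x ≡ y) → ∣ p ∣ ≤ ∣ q ∣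
injection-≤ f p q into inj =
  subst (_≤ ∣ q ∣) (trans (length-map f (elems p)) (elems-length p))
    (unique-length-≤ (map f (elems p)) q
      (map-unique f (elems p) (elems-unique p) (λ x∈ y∈ → inj (elems-sound p x∈) (elems-sound p y∈)))
      (All.tabulate λ fx∈ → let (x , x∈ , fx≡) = ∈-map⁻ f fx∈ in
        subst (_∈ q) (sym fx≡) (into (elems-sound p x∈))))

⋃-⁻ : {x : Fin n} (ps : List (Subset n)) → x ∈ ⋃ ps → ∃ λ p → p ∈ˡ ps × x ∈ p
⋃-⁻ [] x∈ = ⊥-elim (∉⊥ x∈)
⋃-⁻ (p ∷ ps) x∈ with x∈p∪q⁻ p (⋃ ps) x∈
... | inj₁ x∈p = p , here refl , x∈p
... | inj₂ x∈⋃ = let (q , q∈ , x∈q) = ⋃-⁻ ps x∈⋃ in q , there q∈ , x∈q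

⋃-⁺ : {x : Fin n} {p : Subset n} (ps : List (Subset n)) → p ∈ˡ ps → x ∈ p → x ∈ ⋃ ps
⋃-⁺ (p ∷ ps) (here refl) x∈p = x∈p∪q⁺ (inj₁ x∈p)
⋃-⁺ (p ∷ ps) (there p∈) x∈p = x∈p∪q⁺ (inj₂ (⋃-⁺ ps p∈ x∈p))

⋂-⁻ : {x : Fin n} {p : Subset n} (ps : List (Subset n)) → x ∈ ⋂ ps → p ∈ˡ ps → x ∈ p
⋂-⁻ (p ∷ ps) x∈ (here refl) = proj₁ (x∈p∩q⁻ p (⋂ ps) x∈)
⋂-⁻ (p ∷ ps) x∈ (there p∈) = ⋂-⁻ ps (proj₂ (x∈p∩q⁻ p (⋂ ps) x∈)) p∈

⋂-⁺ : {x : Fin n} (ps : List (Subset n)) → (∀ {p} → p ∈ˡ ps → x ∈ p) → x ∈ ⋂ ps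
⋂-⁺ [] h = ∈⊤
⋂-⁺ (p ∷ ps) h = x∈p∩q⁺ (h (here refl) , ⋂-⁺ ps (h ∘ there))

fromList : List (Fin n) → Subset n
fromList [] = ∅
fromList (x ∷ xs) = ⁅ x ⁆ ∪ fromList xs

fromList-⁺ : {x : Fin n} (xs : List (Fin n)) → x ∈ˡ xs → x ∈ fromList xs
fromList-⁺ (y ∷ xs) (here refl) = x∈p∪q⁺ (inj₁ (x∈⁅x⁆ y))
fromList-⁺ (y ∷ xs) (there x∈) = x∈p∪q⁺ (inj₂ (fromList-⁺ xs x∈))

fromList-⁻ : {x : Fin n} (xs : List (Fin n)) → x ∈ fromList xs → x ∈ˡ xs
fromList-⁻ [] x∈ = ⊥-elim (∉⊥ x∈)
fromList-⁻ (y ∷ xs) x∈ with x∈p∪q⁻ ⁅ y ⁆ (fromList xs) x∈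
... | inj₁ x∈⁅y⁆ = here (x∈⁅y⁆⇒x≡y y x∈⁅y⁆)
... | inj₂ x∈xs = there (fromList-⁻ xs x∈xs)

∣fromList∣ : (xs : List (Fin n)) → Unique xs → ∣ fromList xs ∣ ≡ length xs
∣fromList∣ {n} [] [] = ∣⊥∣≡0 n
∣fromList∣ (x ∷ xs) (x∉xs ∷ u) =
  trans (∣p∪q∣≡∣p∣+∣q∣ ⁅ x ⁆ (fromList xs) disj) (cong₂ _+_ (∣⁅x⁆∣≡1 x) (∣fromList∣ xs u))
  where
  disj : Disjoint ⁅ x ⁆ (fromList xs)
  disj y∈⁅x⁆ y∈xs = All.lookup x∉xs (fromList-⁻ xs y∈xs) (sym (x∈⁅y⁆⇒x≡y x y∈⁅x⁆))

allSubsets : ∀ n → List (Subset n)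
allSubsets zero = [] ∷ []
allSubsets (suc n) = map (inside ∷_) (allSubsets n) ++ map (outside ∷_) (allSubsets n)

allSubsets-complete : (p : Subset n) → p ∈ˡ allSubsets n
allSubsets-complete [] = here refl
allSubsets-complete {suc n} (inside ∷ p) = ∈-++⁺ˡ (∈-map⁺ (inside ∷_) (allSubsets-complete p))
allSubsets-complete {suc n} (outside ∷ p) =
  ∈-++⁺ʳ (map (inside ∷_) (allSubsets n)) (∈-map⁺ (outside ∷_) (allSubsets-complete p))

module Greatest {A : Set} (R : A → A → Set)
                (R-total : ∀ x y → R x y ⊎ R y x) (R-trans : ∀ {x y z} → R x y → R y z → R x z)
                (P : A → Set) (P? : ∀ x → Dec (P x)) where

  IsGreatest : List A → A → Set
  IsGreatest xs y = P y × (∀ {x} → x ∈ˡ xs → P x → R x y)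

  R-refl : ∀ x → R x x
  R-refl x = [ (λ r → r) , (λ r → r) ]′ (R-total x x)

  greatest-or-none : (xs : List A) → (∀ {x} → x ∈ˡ xs → ¬ P x) ⊎ ∃ (IsGreatest xs)
  greatest-or-none [] = inj₁ (λ ())
  greatest-or-none (x ∷ xs) with P? x | greatest-or-none xs
  ... | no ¬px | inj₁ none = inj₁ λ { (here refl) → ¬px ; (there z∈) → none z∈ }
  ... | no ¬px | inj₂ (y , py , gy) =
        inj₂ (y , py , λ { (here refl) px → ⊥-elim (¬px px) ; (there z∈) → gy z∈ })
  ... | yes px | inj₁ none =
        inj₂ (x , px , λ { (here refl) _ → R-refl x ; (there z∈) pz → ⊥-elim (none z∈ pz) })
  ... | yes px | inj₂ (y , py , gy) with R-total x y
  ...   | inj₁ x≤y = inj₂ (y , py , λ { (here refl) _ → x≤y ; (there z∈) → gy z∈ })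
  ...   | inj₂ y≤x = inj₂ (x , px , λ { (here refl) _ → R-refl x ; (there z∈) pz → R-trans (gy z∈ pz) y≤x })

  greatest : (xs : List A) → ∃ (λ x → x ∈ˡ xs × P x) → ∃ (IsGreatest xs)
  greatest xs (x , x∈ , px) with greatest-or-none xs
  ... | inj₁ none = ⊥-elim (none x∈ px)
  ... | inj₂ g = g

greatest-subset : (R : Subset n → Subset n → Set) →
                  (∀ x y → R x y ⊎ R y x) → (∀ {x y z} → R x y → R y z → R x z) →
                  (P : Subset n → Set) → (∀ x → Dec (P x)) →
                  ∃ P → ∃ λ y → P y × (∀ {x} → P x → R x y)
greatest-subset R R-total R-trans P P? (x , px) =
  let (y , py , greatest-y) = Greatest.greatest R R-total R-trans P P? (allSubsets _) (x , allSubsets-complete x , px)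
  in y , py , λ {z} pz → greatest-y (allSubsets-complete z) pz

anyFin-⁻ : (p : Fin n → Bool) → foldr (λ _ → Bool) _∨_ false (tabulate p) ≡ true → ∃ λ u → p u ≡ true
anyFin-⁻ {zero} p ()
anyFin-⁻ {suc n} p any≡ with p zero in p0
... | true = zero , p0
... | false = let (u , pu) = anyFin-⁻ (p ∘ suc) any≡ in suc u , pu

anyFin-⁺ : (p : Fin n → Bool) (u : Fin n) → p u ≡ true → foldr (λ _ → Bool) _∨_ false (tabulate p) ≡ true
anyFin-⁺ p zero pu rewrite pu = refl
anyFin-⁺ p (suc u) pu with p zero
... | true = refl
... | false = anyFin-⁺ (p ∘ suc) u pu

-- Transitivity of the comparison i − i' ≤ j − j', written as i + j' ≤ j + i'.
cross-≤-trans : ∀ i i' j j' k k' → i + j' ≤ j + i' → j + k' ≤ k + j' → i + k' ≤ k + i'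
cross-≤-trans i i' j j' k k' ij jk =
  +-cancelˡ-≤ (j + j') (i + k') (k + i') (subst₂ _≤_ (shuffle i j' j k') (shuffle' j i' k j') (+-mono-≤ ij jk))
  where
  shuffle : ∀ i j' j k' → (i + j') + (j + k') ≡ (j + j') + (i + k')
  shuffle = solve-∀
  shuffle' : ∀ j i' k j' → (j + i') + (k + j') ≡ (j + j') + (k + i')
  shuffle' = solve-∀

half-≤ : ∀ s m → s + s ≤ m + m → s ≤ m
half-≤ s m s+s≤m+m with s ≤? m
... | yes s≤m = s≤m
... | no s≰m = let m<s = ≰⇒> s≰m in ⊥-elim (<⇒≱ (+-mono-< m<s m<s) s+s≤m+m)

module _ (a b c e : ℕ) where
  private
    cancel : ∀ x y z → (x ℤ.+ z) ℤ.- (y ℤ.+ z) ≡ x ℤ.- y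
    cancel = ℤSolver.solve-∀
    cancel' : ∀ x y z → (x ℤ.+ y) ℤ.- (y ℤ.+ z) ≡ x ℤ.- z
    cancel' = ℤSolver.solve-∀
    restore : ∀ x y z → (x ℤ.- y) ℤ.+ (y ℤ.+ z) ≡ x ℤ.+ z
    restore = ℤSolver.solve-∀
    restore' : ∀ x y z → (x ℤ.- z) ℤ.+ (y ℤ.+ z) ≡ x ℤ.+ y
    restore' = ℤSolver.solve-∀

  cross-≤⇒-≤ : a + e ≤ c + b → (ℤ.+ a ℤ.- ℤ.+ b) ℤ.≤ (ℤ.+ c ℤ.- ℤ.+ e)
  cross-≤⇒-≤ h = subst₂ ℤ._≤_ (cancel (ℤ.+ a) (ℤ.+ b) (ℤ.+ e)) (cancel' (ℤ.+ c) (ℤ.+ b) (ℤ.+ e))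
                   (ℤP.+-monoˡ-≤ (ℤ.- (ℤ.+ b ℤ.+ ℤ.+ e)) (ℤ.+≤+ h))

  -≤⇒cross-≤ : (ℤ.+ a ℤ.- ℤ.+ b) ℤ.≤ (ℤ.+ c ℤ.- ℤ.+ e) → a + e ≤ c + b
  -≤⇒cross-≤ h = ℤP.drop‿+≤+ (subst₂ ℤ._≤_ (restore (ℤ.+ a) (ℤ.+ b) (ℤ.+ e)) (restore' (ℤ.+ c) (ℤ.+ b) (ℤ.+ e))
                   (ℤP.+-monoˡ-≤ (ℤ.+ b ℤ.+ ℤ.+ e) h))

-- The exchange step behind supermodularity of d: with a = ∣P∪Q∣, b = ∣P∩Q∣,
-- p = ∣P∣, q = ∣Q∣ and x, y, u, v the neighbourhood sizes of P∪Q, P∩Q, P, Q,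
-- d(P∩Q) ≤ d(P) implies d(Q) ≤ d(P∪Q).
exchange-arith : ∀ a b p q x y u v → a + b ≡ p + q → x + y ≤ u + v → b + u ≤ p + y → q + x ≤ a + v
exchange-arith a b p q x y u v a+b≡p+q x+y≤u+v b+u≤p+y = +-cancelʳ-≤ (p + y) (q + x) (a + v) (begin
  (q + x) + (p + y)  ≡⟨ regroup q x p y ⟩
  (p + q) + (x + y)  ≤⟨ +-mono-≤ (≤-reflexive (sym a+b≡p+q)) x+y≤u+v ⟩
  (a + b) + (u + v)  ≡⟨ regroup' a b u v ⟩
  (a + v) + (b + u)  ≤⟨ +-monoʳ-≤ (a + v) b+u≤p+y ⟩
  (a + v) + (p + y)  ∎)
  where
  open ≤-Reasoning
  regroup : ∀ q x p y → (q + x) + (p + y) ≡ (p + q) + (x + y)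
  regroup = solve-∀
  regroup' : ∀ a b u v → (a + b) + (u + v) ≡ (a + v) + (b + u)
  regroup' = solve-∀

+-exchange : ∀ a b c → a + (b + c) ≡ b + (a + c)
+-exchange = solve-∀

module _ {n : ℕ} (G : Graph n) where

  private
    Ind : Subset n → Set
    Ind = Independent G

    N⟨_⟩ : Subset n → Subset n
    N⟨_⟩ = N G

  adj-flip : ∀ {u v} → adj G u v ≡ true → adj G v u ≡ true
  adj-flip {u} {v} uv = trans (adj-sym G v u) uv

  N-⁺ : ∀ {A u v} → u ∈ A → adj G v u ≡ true → v ∈ N⟨ A ⟩
  N-⁺ {A} {u} {v} u∈A vu = lookup⇒[]= v N⟨ A ⟩
    (trans (lookup∘tabulate _ v) (anyFin-⁺ _ u (trans (cong (_∧ adj G v u) ([]=⇒lookup u∈A)) vu)))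

  N-⁻ : ∀ {A v} → v ∈ N⟨ A ⟩ → ∃ λ u → u ∈ A × adj G v u ≡ true
  N-⁻ {A} {v} v∈N with anyFin-⁻ (λ u → lookup A u ∧ adj G v u) (trans (sym (lookup∘tabulate _ v)) ([]=⇒lookup v∈N))
  ... | u , Au∧vu with lookup A u in Au
  ... | true = u , lookup⇒[]= u A Au , Au∧vu

  N-mono : ∀ {P Q} → P ⊆ Q → N⟨ P ⟩ ⊆ N⟨ Q ⟩
  N-mono P⊆Q v∈N = let (u , u∈P , vu) = N-⁻ v∈N in N-⁺ (P⊆Q u∈P) vu

  N-∪ : ∀ P Q → N⟨ P ∪ Q ⟩ ⊆ N⟨ P ⟩ ∪ N⟨ Q ⟩
  N-∪ P Q v∈N with N-⁻ v∈N
  ... | u , u∈P∪Q , vu = x∈p∪q⁺ ([ (λ u∈P → inj₁ (N-⁺ u∈P vu)) , (λ u∈Q → inj₂ (N-⁺ u∈Q vu)) ]′ (x∈p∪q⁻ P Q u∈P∪Q))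

  N-∩ : ∀ P Q → N⟨ P ∩ Q ⟩ ⊆ N⟨ P ⟩ ∩ N⟨ Q ⟩
  N-∩ P Q = λ v∈N → x∈p∩q⁺ (N-mono (p∩q⊆p P Q) v∈N , N-mono (p∩q⊆q P Q) v∈N)

  ind-disjoint-N : ∀ {A} → Ind A → Disjoint A N⟨ A ⟩
  ind-disjoint-N {A} indA {x} x∈A x∈N with N-⁻ x∈N
  ... | u , u∈A , xu with trans (sym xu) (indA x u x∈A u∈A)
  ... | ()

  ind-⊆ : ∀ {A B} → B ⊆ A → Ind A → Ind B
  ind-⊆ B⊆A indA u v u∈B v∈B = indA u v (B⊆A u∈B) (B⊆A v∈B)

  no-edge-between : Subset n → Subset n → Set
  no-edge-between A B = ∀ {u v} → u ∈ A → v ∈ B → adj G u v ≡ false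

  ind-∪ : ∀ {A B} → Ind A → Ind B → no-edge-between A B → Ind (A ∪ B)
  ind-∪ {A} {B} indA indB AB u v u∈ v∈ with x∈p∪q⁻ A B u∈ | x∈p∪q⁻ A B v∈
  ... | inj₁ u∈A | inj₁ v∈A = indA u v u∈A v∈A
  ... | inj₂ u∈B | inj₂ v∈B = indB u v u∈B v∈B
  ... | inj₁ u∈A | inj₂ v∈B = AB u∈A v∈B
  ... | inj₂ u∈B | inj₁ v∈A = trans (adj-sym G u v) (AB v∈A u∈B)

  ind-⁅⁆ : ∀ v → Ind ⁅ v ⁆
  ind-⁅⁆ v u w u∈ w∈ rewrite x∈⁅y⁆⇒x≡y v u∈ | x∈⁅y⁆⇒x≡y v w∈ = irrefl G v

  no-edge-outside-N : ∀ {A B} → (∀ {v} → v ∈ B → v ∉ N⟨ A ⟩) → no-edge-between A B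
  no-edge-outside-N {A} {B} B∩N=∅ {u} {v} u∈A v∈B with adj G u v in uv
  ... | false = refl
  ... | true = ⊥-elim (B∩N=∅ v∈B (N-⁺ u∈A (adj-flip uv)))

  ind? : ∀ A → Dec (Ind A)
  ind? A = all? λ u → all? λ v → (u ∈? A) →-dec ((v ∈? A) →-dec (adj G u v ≟ᵇ false))

  -- I ≼ J states d(I) ≤ d(J) in subtraction-free form.
  _≼_ : Subset n → Subset n → Set
  I ≼ J = ∣ I ∣ + ∣ N⟨ J ⟩ ∣ ≤ ∣ J ∣ + ∣ N⟨ I ⟩ ∣

  ≼⇔d≤ : ∀ I J → I ≼ J ⇔ d G I ℤ.≤ d G J
  ≼⇔d≤ I J = mk⇔ (cross-≤⇒-≤ (∣ I ∣) (∣ N⟨ I ⟩ ∣) (∣ J ∣) (∣ N⟨ J ⟩ ∣)) (-≤⇒cross-≤ (∣ I ∣) (∣ N⟨ I ⟩ ∣) (∣ J ∣) (∣ N⟨ J ⟩ ∣))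

  ≼-trans : ∀ {I J K} → I ≼ J → J ≼ K → I ≼ K
  ≼-trans {I} {J} {K} = cross-≤-trans (∣ I ∣) (∣ N⟨ I ⟩ ∣) (∣ J ∣) (∣ N⟨ J ⟩ ∣) (∣ K ∣) (∣ N⟨ K ⟩ ∣)

  ≼-total : ∀ I J → I ≼ J ⊎ J ≼ I
  ≼-total I J = ≤-total (∣ I ∣ + ∣ N⟨ J ⟩ ∣) (∣ J ∣ + ∣ N⟨ I ⟩ ∣)

  Critical : Subset n → Set
  Critical A = Ind A × (∀ I → Ind I → I ≼ A)

  MaxCritical : Subset n → Set
  MaxCritical A = Critical A × (∀ B → Critical B → ∣ B ∣ ≤ ∣ A ∣)

  critical⇔ : ∀ {A} → IsCritical G A ⇔ Critical A
  critical⇔ {A} = mk⇔ (λ (indA , max) → indA , λ I indI → Equivalence.from (≼⇔d≤ I A) (max I indI))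
                      (λ (indA , max) → indA , λ I indI → Equivalence.to (≼⇔d≤ I A) (max I indI))

  maxCritical⇔ : ∀ {A} → IsMaxCritical G A ⇔ MaxCritical A
  maxCritical⇔ = mk⇔ (λ (crit , max) → Equivalence.to critical⇔ crit , λ B → max B ∘ Equivalence.from critical⇔)
                     (λ (crit , max) → Equivalence.from critical⇔ crit , λ B → max B ∘ Equivalence.to critical⇔)

  -- d is supermodular because N is submodular: ∣N(P∪Q)∣ + ∣N(P∩Q)∣ ≤ ∣N(P)∣ + ∣N(Q)∣.
  N-submodular : ∀ P Q → ∣ N⟨ P ∪ Q ⟩ ∣ + ∣ N⟨ P ∩ Q ⟩ ∣ ≤ ∣ N⟨ P ⟩ ∣ + ∣ N⟨ Q ⟩ ∣
  N-submodular P Q = ≤-trans (+-mono-≤ (p⊆q⇒∣p∣≤∣q∣ (N-∪ P Q)) (p⊆q⇒∣p∣≤∣q∣ (N-∩ P Q)))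
                             (≤-reflexive (∣p∪q∣+∣p∩q∣≡∣p∣+∣q∣ N⟨ P ⟩ N⟨ Q ⟩))

  ≼-exchange : ∀ P Q → (P ∩ Q) ≼ P → Q ≼ (P ∪ Q)
  ≼-exchange P Q = exchange-arith (∣ P ∪ Q ∣) (∣ P ∩ Q ∣) (∣ P ∣) (∣ Q ∣)
                     (∣ N⟨ P ∪ Q ⟩ ∣) (∣ N⟨ P ∩ Q ⟩ ∣) (∣ N⟨ P ⟩ ∣) (∣ N⟨ Q ⟩ ∣)
                     (∣p∪q∣+∣p∩q∣≡∣p∣+∣q∣ P Q) (N-submodular P Q)

  reduct : Subset n → Subset n
  reduct X = X ─ N⟨ X ⟩

  reduct-isolated : ∀ X → no-edge-between X (reduct X)
  reduct-isolated X = no-edge-outside-N (x∈p─q⇒x∉q X N⟨ X ⟩)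

  reduct-ind : ∀ X → Ind (reduct X)
  reduct-ind X u v u∈ v∈ = reduct-isolated X (p─q⊆p X N⟨ X ⟩ u∈) v∈

  reduct-≼ : ∀ X → X ≼ reduct X
  reduct-≼ X = begin
    ∣ X ∣ + ∣ N⟨ K ⟩ ∣                          ≡⟨ cong (_+ ∣ N⟨ K ⟩ ∣) (∣p∩q∣+∣p─q∣≡∣p∣ X N⟨ X ⟩) ⟨
    (∣ X ∩ N⟨ X ⟩ ∣ + ∣ K ∣) + ∣ N⟨ K ⟩ ∣       ≤⟨ +-monoʳ-≤ (∣ X ∩ N⟨ X ⟩ ∣ + ∣ K ∣) (p⊆q⇒∣p∣≤∣q∣ N⟨K⟩⊆N⟨X⟩─X) ⟩
    (∣ X ∩ N⟨ X ⟩ ∣ + ∣ K ∣) + ∣ N⟨ X ⟩ ─ X ∣   ≡⟨ +-assoc (∣ X ∩ N⟨ X ⟩ ∣) (∣ K ∣) (∣ N⟨ X ⟩ ─ X ∣) ⟩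
    ∣ X ∩ N⟨ X ⟩ ∣ + (∣ K ∣ + ∣ N⟨ X ⟩ ─ X ∣)   ≡⟨ +-exchange (∣ X ∩ N⟨ X ⟩ ∣) (∣ K ∣) (∣ N⟨ X ⟩ ─ X ∣) ⟩
    ∣ K ∣ + (∣ X ∩ N⟨ X ⟩ ∣ + ∣ N⟨ X ⟩ ─ X ∣)   ≡⟨ cong (λ P → ∣ K ∣ + (∣ P ∣ + ∣ N⟨ X ⟩ ─ X ∣)) (∩-comm X N⟨ X ⟩) ⟩
    ∣ K ∣ + (∣ N⟨ X ⟩ ∩ X ∣ + ∣ N⟨ X ⟩ ─ X ∣)   ≡⟨ cong (∣ K ∣ +_) (∣p∩q∣+∣p─q∣≡∣p∣ N⟨ X ⟩ X) ⟩
    ∣ K ∣ + ∣ N⟨ X ⟩ ∣                          ∎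
    where
    open ≤-Reasoning
    K = reduct X
    N⟨K⟩⊆N⟨X⟩─X : N⟨ K ⟩ ⊆ N⟨ X ⟩ ─ X
    N⟨K⟩⊆N⟨X⟩─X v∈N with N-⁻ v∈N
    ... | u , u∈K , vu = x∈p∧x∉q⇒x∈p─q (N-mono (p─q⊆p X N⟨ X ⟩) v∈N)
                           (λ v∈X → x∈p─q⇒x∉q X N⟨ X ⟩ u∈K (N-⁺ v∈X (adj-flip vu)))

  -- For critical A and A', the independent set A ∪ reduct(A ∪ A') is critical:
  -- d(A') ≤ d(A ∪ A') ≤ d(reduct(A ∪ A')) ≤ d(A ∪ reduct(A ∪ A')).
  critical-∪-reduct : ∀ {A A'} → Critical A → Critical A' → Critical (A ∪ reduct (A ∪ A'))
  critical-∪-reduct {A} {A'} (indA , maxA) (indA' , maxA') =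
    ind-∪ indA (reduct-ind X) (λ u∈A → reduct-isolated X (p⊆p∪q A' u∈A)) ,
    λ I indI → ≼-trans {I} {A'} {A ∪ K} (maxA' I indI)
                  (≼-trans {A'} {X} {A ∪ K} A'≼X (≼-trans {X} {K} {A ∪ K} (reduct-≼ X) K≼A∪K))
    where
    X = A ∪ A'
    K = reduct X
    A'≼X : A' ≼ X
    A'≼X = ≼-exchange A A' (maxA (A ∩ A') (ind-⊆ (p∩q⊆p A A') indA))
    K≼A∪K : K ≼ (A ∪ K)
    K≼A∪K = ≼-exchange A K (maxA (A ∩ K) (ind-⊆ (p∩q⊆p A K) indA))

  -- Every critical set lies in A ∪ N(A) when A is a maximum critical set:
  -- a vertex of A' outside A ∪ N(A) would enlarge A to the critical A ∪ reduct(A ∪ A').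
  critical-⊆-∪N : ∀ {A A'} → MaxCritical A → Critical A' → A' ⊆ A ∪ N⟨ A ⟩
  critical-⊆-∪N {A} {A'} (critA , maxA) critA' {x} x∈A' with x ∈? A | x ∈? N⟨ A ⟩
  ... | yes x∈A | _ = x∈p∪q⁺ (inj₁ x∈A)
  ... | no _ | yes x∈N = x∈p∪q⁺ (inj₂ x∈N)
  ... | no x∉A | no x∉N = ⊥-elim (<⇒≱ A<A∪K (maxA (A ∪ K) (critical-∪-reduct critA critA')))
    where
    K = reduct (A ∪ A')
    x∉N⟨A∪A'⟩ : x ∉ N⟨ A ∪ A' ⟩
    x∉N⟨A∪A'⟩ x∈N = [ x∉N , ind-disjoint-N (proj₁ critA') x∈A' ]′ (x∈p∪q⁻ N⟨ A ⟩ N⟨ A' ⟩ (N-∪ A A' x∈N))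
    A<A∪K : ∣ A ∣ < ∣ A ∪ K ∣
    A<A∪K = ⊆-∉⇒∣∣< (p⊆p∪q K) (x∈p∪q⁺ (inj₂ (x∈p∧x∉q⇒x∈p─q (x∈p∪q⁺ (inj₂ x∈A')) x∉N⟨A∪A'⟩))) x∉A

  -- Larson's lemma: for critical A, every T ⊆ N(A) satisfies ∣T∣ ≤ ∣A ∩ N(T)∣,
  -- since A ─ N(T) is independent and its neighbourhood misses T.
  critical-hall : ∀ {A T} → Critical A → T ⊆ N⟨ A ⟩ → ∣ T ∣ ≤ ∣ A ∩ N⟨ T ⟩ ∣
  critical-hall {A} {T} (indA , maxA) T⊆N = +-cancelʳ-≤ (∣ A' ∣ + ∣ N⟨ A ⟩ ─ T ∣) (∣ T ∣) (∣ A ∩ N⟨ T ⟩ ∣) (begin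
    ∣ T ∣ + (∣ A' ∣ + ∣ N⟨ A ⟩ ─ T ∣)           ≡⟨ +-exchange (∣ T ∣) (∣ A' ∣) (∣ N⟨ A ⟩ ─ T ∣) ⟩
    ∣ A' ∣ + (∣ T ∣ + ∣ N⟨ A ⟩ ─ T ∣)           ≡⟨ cong (λ P → ∣ A' ∣ + (∣ P ∣ + ∣ N⟨ A ⟩ ─ T ∣)) N⟨A⟩∩T≡T ⟨
    ∣ A' ∣ + (∣ N⟨ A ⟩ ∩ T ∣ + ∣ N⟨ A ⟩ ─ T ∣)  ≡⟨ cong (∣ A' ∣ +_) (∣p∩q∣+∣p─q∣≡∣p∣ N⟨ A ⟩ T) ⟩
    ∣ A' ∣ + ∣ N⟨ A ⟩ ∣                         ≤⟨ maxA A' (ind-⊆ (p─q⊆p A N⟨ T ⟩) indA) ⟩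
    ∣ A ∣ + ∣ N⟨ A' ⟩ ∣                         ≤⟨ +-monoʳ-≤ (∣ A ∣) (p⊆q⇒∣p∣≤∣q∣ N⟨A'⟩⊆N⟨A⟩─T) ⟩
    ∣ A ∣ + ∣ N⟨ A ⟩ ─ T ∣                      ≡⟨ cong (_+ ∣ N⟨ A ⟩ ─ T ∣) (∣p∩q∣+∣p─q∣≡∣p∣ A N⟨ T ⟩) ⟨
    (∣ A ∩ N⟨ T ⟩ ∣ + ∣ A' ∣) + ∣ N⟨ A ⟩ ─ T ∣  ≡⟨ +-assoc (∣ A ∩ N⟨ T ⟩ ∣) (∣ A' ∣) (∣ N⟨ A ⟩ ─ T ∣) ⟩
    ∣ A ∩ N⟨ T ⟩ ∣ + (∣ A' ∣ + ∣ N⟨ A ⟩ ─ T ∣)  ∎)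
    where
    open ≤-Reasoning
    A' = A ─ N⟨ T ⟩
    N⟨A⟩∩T≡T : N⟨ A ⟩ ∩ T ≡ T
    N⟨A⟩∩T≡T = ⊆-antisym (p∩q⊆q N⟨ A ⟩ T) (λ x∈T → x∈p∩q⁺ (T⊆N x∈T , x∈T))
    N⟨A'⟩⊆N⟨A⟩─T : N⟨ A' ⟩ ⊆ N⟨ A ⟩ ─ T
    N⟨A'⟩⊆N⟨A⟩─T v∈N with N-⁻ v∈N
    ... | u , u∈A' , vu = x∈p∧x∉q⇒x∈p─q (N-mono (p─q⊆p A N⟨ T ⟩) v∈N)
                            (λ v∈T → x∈p─q⇒x∉q A N⟨ T ⟩ u∈A' (N-⁺ v∈T (adj-flip vu)))

  -- A maximum critical set exists: take I₀ of greatest difference, then a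
  -- largest independent set whose difference is at least d(I₀).
  maxCritical-exists : ∃ MaxCritical
  maxCritical-exists =
    let (I₀ , indI₀ , I₀-greatest) = greatest-subset _≼_ ≼-total (λ {I} {J} {K} → ≼-trans {I} {J} {K}) Ind ind? (∅ , ind-∅)
        (A , (indA , I₀≼A) , A-largest) =
          greatest-subset (λ S T → ∣ S ∣ ≤ ∣ T ∣) (λ S T → ≤-total ∣ S ∣ ∣ T ∣) ≤-trans
                          (λ S → Ind S × I₀ ≼ S) (λ S → ind? S ×-dec (_ ≤? _)) (I₀ , indI₀ , ≤-refl)
    in A , (indA , λ I indI → ≼-trans {I} {I₀} {A} (I₀-greatest indI) I₀≼A) ,
           λ B (indB , B-critical) → A-largest {B} (indB , B-critical I₀ indI₀)
    where
    ind-∅ : Ind ∅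
    ind-∅ u v u∈∅ = ⊥-elim (∉⊥ u∈∅)

  Saturating : Subset n → Subset n → Set
  Saturating L R = Σ (Fin n → Fin n) λ f → (∀ {u} → u ∈ L → f u ∈ R × adj G u (f u) ≡ true)
                                          × (∀ {u w} → u ∈ L → w ∈ L → f u ≡ f w → u ≡ w)

  HallCondition : Subset n → Subset n → Set
  HallCondition L R = ∀ T → T ⊆ L → ∣ T ∣ ≤ ∣ R ∩ N⟨ T ⟩ ∣

  saturating-empty : ∀ {L R} → ¬ Nonempty L → Saturating L R
  saturating-empty L-empty = (λ u → u) , (λ u∈L → ⊥-elim (L-empty (_ , u∈L))) , (λ u∈L → ⊥-elim (L-empty (_ , u∈L)))

  saturating-edge : ∀ {x y} → adj G x y ≡ true → Saturating ⁅ x ⁆ ⁅ y ⁆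
  saturating-edge {x} {y} xy =
    (λ _ → y) ,
    (λ u∈ → x∈⁅x⁆ y , subst (λ u → adj G u y ≡ true) (sym (x∈⁅y⁆⇒x≡y x u∈)) xy) ,
    (λ u∈ w∈ _ → trans (x∈⁅y⁆⇒x≡y x u∈) (sym (x∈⁅y⁆⇒x≡y x w∈)))

  saturating-glue : ∀ {L L₁ R R₁ R₂} → R₁ ⊆ R → R₂ ⊆ R → Disjoint R₁ R₂ →
                    Saturating L₁ R₁ → Saturating (L ─ L₁) R₂ → Saturating L R
  saturating-glue {L} {L₁} {R} {R₁} {R₂} R₁⊆R R₂⊆R R₁∩R₂=∅ (f₁ , into₁ , injective₁) (f₂ , into₂ , injective₂) =
    (λ u → pick (u ∈? L₁)) , (λ {u} u∈L → pick-into (u ∈? L₁) u∈L) ,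
    (λ {u} {w} u∈L w∈L → pick-inj (u ∈? L₁) (w ∈? L₁) u∈L w∈L)
    where
    pick : ∀ {u} → Dec (u ∈ L₁) → Fin n
    pick {u} (yes _) = f₁ u
    pick {u} (no _) = f₂ u

    pick-into : ∀ {u} (d : Dec (u ∈ L₁)) → u ∈ L → pick d ∈ R × adj G u (pick d) ≡ true
    pick-into (yes u∈L₁) u∈L = let (fu∈ , ufu) = into₁ u∈L₁ in R₁⊆R fu∈ , ufu
    pick-into (no u∉L₁) u∈L = let (fu∈ , ufu) = into₂ (x∈p∧x∉q⇒x∈p─q u∈L u∉L₁) in R₂⊆R fu∈ , ufu

    pick-inj : ∀ {u w} (du : Dec (u ∈ L₁)) (dw : Dec (w ∈ L₁)) → u ∈ L → w ∈ L → pick du ≡ pick dw → u ≡ w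
    pick-inj (yes u∈) (yes w∈) _ _ fu≡fw = injective₁ u∈ w∈ fu≡fw
    pick-inj (no u∉) (no w∉) u∈L w∈L fu≡fw = injective₂ (x∈p∧x∉q⇒x∈p─q u∈L u∉) (x∈p∧x∉q⇒x∈p─q w∈L w∉) fu≡fw
    pick-inj (yes u∈) (no w∉) _ w∈L fu≡fw =
      ⊥-elim (R₁∩R₂=∅ (proj₁ (into₁ u∈)) (subst (_∈ R₂) (sym fu≡fw) (proj₁ (into₂ (x∈p∧x∉q⇒x∈p─q w∈L w∉)))))
    pick-inj (no u∉) (yes w∈) u∈L _ fu≡fw =
      ⊥-elim (R₁∩R₂=∅ (proj₁ (into₁ w∈)) (subst (_∈ R₂) fu≡fw (proj₁ (into₂ (x∈p∧x∉q⇒x∈p─q u∈L u∉)))))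

  Tight : Subset n → Subset n → Subset n → Set
  Tight L R T = T ⊆ L × Nonempty T × ∣ T ∣ < ∣ L ∣ × ∣ R ∩ N⟨ T ⟩ ∣ ≤ ∣ T ∣

  tight? : ∀ L R T → Dec (Tight L R T)
  tight? L R T = (T ⊆? L) ×-dec (nonempty? T ×-dec ((∣ T ∣ <? ∣ L ∣) ×-dec (∣ R ∩ N⟨ T ⟩ ∣ ≤? ∣ T ∣)))

  hall-inner : ∀ {L R T} → HallCondition L R → T ⊆ L → HallCondition T (R ∩ N⟨ T ⟩)
  hall-inner {L} {R} {T} hallLR T⊆L S S⊆T = ≤-trans (hallLR S (⊆-trans S⊆T T⊆L)) (p⊆q⇒∣p∣≤∣q∣ sub)
    where
    sub : R ∩ N⟨ S ⟩ ⊆ (R ∩ N⟨ T ⟩) ∩ N⟨ S ⟩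
    sub v∈ = let (v∈R , v∈N) = x∈p∩q⁻ R N⟨ S ⟩ v∈ in x∈p∩q⁺ (x∈p∩q⁺ (v∈R , N-mono S⊆T v∈N) , v∈N)

  hall-outer : ∀ {L R T} → HallCondition L R → T ⊆ L → ∣ R ∩ N⟨ T ⟩ ∣ ≤ ∣ T ∣ → HallCondition (L ─ T) (R ─ N⟨ T ⟩)
  hall-outer {L} {R} {T} hallLR T⊆L tight S S⊆L─T = +-cancelʳ-≤ (∣ T ∣) (∣ S ∣) (∣ R' ∩ N⟨ S ⟩ ∣) (begin
    ∣ S ∣ + ∣ T ∣                               ≡⟨ ∣p∪q∣≡∣p∣+∣q∣ S T (λ x∈S → x∈p─q⇒x∉q L T (S⊆L─T x∈S)) ⟨
    ∣ S ∪ T ∣                                   ≤⟨ hallLR (S ∪ T) S∪T⊆L ⟩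
    ∣ R ∩ N⟨ S ∪ T ⟩ ∣                          ≤⟨ p⊆q⇒∣p∣≤∣q∣ split ⟩
    ∣ (R ∩ N⟨ T ⟩) ∪ (R' ∩ N⟨ S ⟩) ∣            ≤⟨ ∣p∪q∣≤∣p∣+∣q∣ (R ∩ N⟨ T ⟩) (R' ∩ N⟨ S ⟩) ⟩
    ∣ R ∩ N⟨ T ⟩ ∣ + ∣ R' ∩ N⟨ S ⟩ ∣            ≤⟨ +-monoˡ-≤ (∣ R' ∩ N⟨ S ⟩ ∣) tight ⟩
    ∣ T ∣ + ∣ R' ∩ N⟨ S ⟩ ∣                     ≡⟨ +-comm (∣ T ∣) (∣ R' ∩ N⟨ S ⟩ ∣) ⟩
    ∣ R' ∩ N⟨ S ⟩ ∣ + ∣ T ∣                     ∎)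
    where
    open ≤-Reasoning
    R' = R ─ N⟨ T ⟩
    S∪T⊆L : S ∪ T ⊆ L
    S∪T⊆L x∈ = [ p─q⊆p L T ∘ S⊆L─T , T⊆L ]′ (x∈p∪q⁻ S T x∈)
    split : R ∩ N⟨ S ∪ T ⟩ ⊆ (R ∩ N⟨ T ⟩) ∪ (R' ∩ N⟨ S ⟩)
    split {v} v∈ with x∈p∩q⁻ R N⟨ S ∪ T ⟩ v∈ | v ∈? N⟨ T ⟩
    ... | v∈R , _ | yes v∈NT = x∈p∪q⁺ (inj₁ (x∈p∩q⁺ (v∈R , v∈NT)))
    ... | v∈R , v∈N | no v∉NT = x∈p∪q⁺ (inj₂ (x∈p∩q⁺ (x∈p∧x∉q⇒x∈p─q v∈R v∉NT ,
            [ (λ v∈NS → v∈NS) , (λ v∈NT → ⊥-elim (v∉NT v∈NT)) ]′ (x∈p∪q⁻ N⟨ S ⟩ N⟨ T ⟩ (N-∪ S T v∈N)))))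

  hall-delete : ∀ {L R x y} → HallCondition L R → (∀ T → ¬ Tight L R T) → x ∈ L → HallCondition (L - x) (R - y)
  hall-delete {L} {R} {x} {y} hallLR no-tight x∈L T T⊆L-x with nonempty? T
  ... | no T-empty = ≤-trans (≤-reflexive (empty-∣∣≡0 T T-empty)) z≤n
  ... | yes T-nonempty = s≤s⁻¹ (begin-strict
    ∣ T ∣                              <⟨ ≰⇒> (λ ∣RNT∣≤∣T∣ → no-tight T (T⊆L , T-nonempty , ∣T∣<∣L∣ , ∣RNT∣≤∣T∣)) ⟩
    ∣ R ∩ N⟨ T ⟩ ∣                     ≤⟨ p⊆q⇒∣p∣≤∣q∣ sub ⟩
    ∣ ((R - y) ∩ N⟨ T ⟩) ∪ ⁅ y ⁆ ∣     ≤⟨ ∣p∪q∣≤∣p∣+∣q∣ ((R - y) ∩ N⟨ T ⟩) ⁅ y ⁆ ⟩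
    ∣ (R - y) ∩ N⟨ T ⟩ ∣ + ∣ ⁅ y ⁆ ∣   ≡⟨ cong (∣ (R - y) ∩ N⟨ T ⟩ ∣ +_) (∣⁅x⁆∣≡1 y) ⟩
    ∣ (R - y) ∩ N⟨ T ⟩ ∣ + 1           ≡⟨ +-comm (∣ (R - y) ∩ N⟨ T ⟩ ∣) 1 ⟩
    suc ∣ (R - y) ∩ N⟨ T ⟩ ∣           ∎)
    where
    open ≤-Reasoning
    T⊆L : T ⊆ L
    T⊆L = p─q⊆p L ⁅ x ⁆ ∘ T⊆L-x
    ∣T∣<∣L∣ : ∣ T ∣ < ∣ L ∣
    ∣T∣<∣L∣ = ≤-<-trans (p⊆q⇒∣p∣≤∣q∣ T⊆L-x) (x∈p⇒∣p-x∣<∣p∣ x∈L)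
    sub : R ∩ N⟨ T ⟩ ⊆ ((R - y) ∩ N⟨ T ⟩) ∪ ⁅ y ⁆
    sub {v} v∈ with v ≟ᶠ y
    ... | yes refl = x∈p∪q⁺ (inj₂ (x∈⁅x⁆ y))
    ... | no v≢y = let (v∈R , v∈N) = x∈p∩q⁻ R N⟨ T ⟩ v∈ in x∈p∪q⁺ (inj₁ (x∈p∩q⁺ (x∈p∧x≢y⇒x∈p-y v∈R v≢y , v∈N)))

  HallUpTo : ℕ → Set
  HallUpTo k = ∀ L R → ∣ L ∣ ≤ k → HallCondition L R → Saturating L R

  -- A tight T splits the problem into T → R ∩ N(T) and L ─ T → R ─ N(T).
  hall-tight : ∀ {k L R T} → HallUpTo k → ∣ L ∣ ≤ suc k → HallCondition L R → Tight L R T → Saturating L R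
  hall-tight {k} {L} {R} {T} hall-k ∣L∣≤1+k hallLR (T⊆L , (x , x∈T) , ∣T∣<∣L∣ , tight) =
    saturating-glue (p∩q⊆p R N⟨ T ⟩) (p─q⊆p R N⟨ T ⟩)
      (λ v∈R∩N v∈R─N → x∈p─q⇒x∉q R N⟨ T ⟩ v∈R─N (p∩q⊆q R N⟨ T ⟩ v∈R∩N))
      (hall-k T (R ∩ N⟨ T ⟩) (s≤s⁻¹ (≤-trans ∣T∣<∣L∣ ∣L∣≤1+k)) (hall-inner {L} {R} hallLR T⊆L))
      (hall-k (L ─ T) (R ─ N⟨ T ⟩) (s≤s⁻¹ (≤-trans ∣L─T∣<∣L∣ ∣L∣≤1+k)) (hall-outer {L} {R} hallLR T⊆L tight))
    where
    ∣L─T∣<∣L∣ : ∣ L ─ T ∣ < ∣ L ∣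
    ∣L─T∣<∣L∣ = p∩q≢∅⇒∣p─q∣<∣p∣ L T (x , x∈p∩q⁺ (T⊆L x∈T , x∈T))

  -- Without tight sets, match x ∈ L to any neighbour y ∈ R and recurse on L - x, R - y.
  hall-slack : ∀ {k L R x} → HallUpTo k → ∣ L ∣ ≤ suc k → HallCondition L R → x ∈ L →
               (∀ T → ¬ Tight L R T) → Saturating L R
  hall-slack {k} {L} {R} {x} hall-k ∣L∣≤1+k hallLR x∈L no-tight =
    saturating-glue ⁅y⁆⊆R (p─q⊆p R ⁅ y ⁆) (λ v∈⁅y⁆ v∈R-y → x∈p─q⇒x∉q R ⁅ y ⁆ v∈R-y v∈⁅y⁆)
      (saturating-edge xy)
      (hall-k (L - x) (R - y) (s≤s⁻¹ (≤-trans (x∈p⇒∣p-x∣<∣p∣ x∈L) ∣L∣≤1+k)) (hall-delete {L} {R} {x} {y} hallLR no-tight x∈L))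
    where
    ⁅x⁆⊆L : ⁅ x ⁆ ⊆ L
    ⁅x⁆⊆L v∈ = subst (_∈ L) (sym (x∈⁅y⁆⇒x≡y x v∈)) x∈L
    neighbour : ∃ λ y → y ∈ R × adj G x y ≡ true
    neighbour with nonempty-of-size (R ∩ N⟨ ⁅ x ⁆ ⟩) (subst (_≤ ∣ R ∩ N⟨ ⁅ x ⁆ ⟩ ∣) (∣⁅x⁆∣≡1 x) (hallLR ⁅ x ⁆ ⁅x⁆⊆L))
    ... | y , y∈ with x∈p∩q⁻ R N⟨ ⁅ x ⁆ ⟩ y∈
    ... | y∈R , y∈N with N-⁻ y∈N
    ... | x' , x'∈⁅x⁆ , yx' = y , y∈R , adj-flip (subst (λ z → adj G y z ≡ true) (x∈⁅y⁆⇒x≡y x x'∈⁅x⁆) yx')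
    y = proj₁ neighbour
    xy = proj₂ (proj₂ neighbour)
    ⁅y⁆⊆R : ⁅ y ⁆ ⊆ R
    ⁅y⁆⊆R v∈ = subst (_∈ R) (sym (x∈⁅y⁆⇒x≡y y v∈)) (proj₁ (proj₂ neighbour))

  hall : ∀ k → HallUpTo k
  hall k L R ∣L∣≤k hallLR with nonempty? L
  ... | no L-empty = saturating-empty L-empty
  hall zero L R ∣L∣≤0 hallLR | yes (x , x∈L) = ⊥-elim (n≮0 (≤-trans (x∈p⇒∣p-x∣<∣p∣ x∈L) ∣L∣≤0))
  hall (suc k) L R ∣L∣≤1+k hallLR | yes (x , x∈L) with anySubset? (tight? L R)
  ... | yes (T , T-tight) = hall-tight (hall k) ∣L∣≤1+k hallLR T-tight
  ... | no no-tight = hall-slack (hall k) ∣L∣≤1+k hallLR x∈L (λ T T-tight → no-tight (T , T-tight))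

  Edges : Set
  Edges = List (Fin n × Fin n)

  partner : Edges → Fin n → Fin n
  partner [] x = x
  partner ((u , v) ∷ M) x with x ≟ᶠ u | x ≟ᶠ v
  ... | yes _ | _ = v
  ... | no _ | yes _ = u
  ... | no _ | no _ = partner M x

  private
    partner-head : ∀ u v M → partner ((u , v) ∷ M) u ≡ v
    partner-head u v M with u ≟ᶠ u
    ... | yes _ = refl
    ... | no u≢u = ⊥-elim (u≢u refl)

    partner-head' : ∀ u v M → u ≢ v → partner ((u , v) ∷ M) v ≡ u
    partner-head' u v M u≢v with v ≟ᶠ u | v ≟ᶠ v
    ... | yes v≡u | _ = ⊥-elim (u≢v (sym v≡u))
    ... | no _ | yes _ = refl
    ... | no _ | no v≢v = ⊥-elim (v≢v refl)

    partner-tail : ∀ u v M x → x ≢ u → x ≢ v → partner ((u , v) ∷ M) x ≡ partner M x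
    partner-tail u v M x x≢u x≢v with x ≟ᶠ u | x ≟ᶠ v
    ... | yes x≡u | _ = ⊥-elim (x≢u x≡u)
    ... | no _ | yes x≡v = ⊥-elim (x≢v x≡v)
    ... | no _ | no _ = refl

    not-head : ∀ {u v x} (M : Edges) → Unique (endpoints G ((u , v) ∷ M)) → x ∈ˡ endpoints G M → x ≢ u × x ≢ v
    not-head M ((_ ∷ u∉M) ∷ v∉M ∷ _) x∈M = (λ x≡u → All.lookup u∉M x∈M (sym x≡u)) , (λ x≡v → All.lookup v∉M x∈M (sym x≡v))

  partner-∈ : ∀ M {x} → Unique (endpoints G M) → x ∈ˡ endpoints G M → partner M x ∈ˡ endpoints G M
  partner-∈ ((u , v) ∷ M) _ (here refl) = subst (_∈ˡ u ∷ v ∷ endpoints G M) (sym (partner-head u v M)) (there (here refl))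
  partner-∈ ((u , v) ∷ M) ((u≢v ∷ _) ∷ _) (there (here refl)) = subst (_∈ˡ u ∷ v ∷ endpoints G M) (sym (partner-head' u v M u≢v)) (here refl)
  partner-∈ ((u , v) ∷ M) {x} U@(_ ∷ _ ∷ U') (there (there x∈M)) =
    let (x≢u , x≢v) = not-head M U x∈M
    in subst (_∈ˡ u ∷ v ∷ endpoints G M) (sym (partner-tail u v M x x≢u x≢v)) (there (there (partner-∈ M U' x∈M)))

  partner-involutive : ∀ M {x} → Unique (endpoints G M) → x ∈ˡ endpoints G M → partner M (partner M x) ≡ x
  partner-involutive ((u , v) ∷ M) ((u≢v ∷ _) ∷ _) (here refl) =
    trans (cong (partner _) (partner-head u v M)) (partner-head' u v M u≢v)
  partner-involutive ((u , v) ∷ M) ((u≢v ∷ _) ∷ _) (there (here refl)) =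
    trans (cong (partner _) (partner-head' u v M u≢v)) (partner-head u v M)
  partner-involutive ((u , v) ∷ M) {x} U@(_ ∷ _ ∷ U') (there (there x∈M)) =
    let (x≢u , x≢v) = not-head M U x∈M
        (px≢u , px≢v) = not-head M U (partner-∈ M U' x∈M)
    in trans (cong (partner _) (partner-tail u v M x x≢u x≢v))
             (trans (partner-tail u v M (partner M x) px≢u px≢v) (partner-involutive M U' x∈M))

  partner-adj : ∀ M {x} → IsMatching G M → x ∈ˡ endpoints G M → adj G x (partner M x) ≡ true
  partner-adj ((u , v) ∷ M) (uv ∷ _ , _) (here refl) = subst (λ w → adj G u w ≡ true) (sym (partner-head u v M)) uv
  partner-adj ((u , v) ∷ M) (uv ∷ _ , (u≢v ∷ _) ∷ _) (there (here refl)) =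
    subst (λ w → adj G v w ≡ true) (sym (partner-head' u v M u≢v)) (adj-flip uv)
  partner-adj ((u , v) ∷ M) {x} (_ ∷ adjM , U@(_ ∷ _ ∷ U')) (there (there x∈M)) =
    let (x≢u , x≢v) = not-head M U x∈M
    in subst (λ w → adj G x w ≡ true) (sym (partner-tail u v M x x≢u x≢v)) (partner-adj M (adjM , U') x∈M)

  endpoints-length : ∀ M → length (endpoints G M) ≡ length M + length M
  endpoints-length [] = refl
  endpoints-length ((u , v) ∷ M) = cong suc (trans (cong suc (endpoints-length M)) (sym (+-suc (length M) (length M))))

  saturating⇒matching : ∀ {L R} → Disjoint L R → Saturating L R → ∃ λ M → IsMatching G M × length M ≡ ∣ L ∣
  saturating⇒matching {L} {R} L∩R=∅ (f , into , injective) =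
    edges (elems L) ,
    (All.tabulate (λ e∈ → let (u , u∈ , e≡) = ∈-map⁻ edge e∈ in subst (λ { (u , v) → adj G u v ≡ true }) (sym e≡) (proj₂ (into (elems-sound L u∈)))) ,
     unique (elems L) (elems-unique L) (All.tabulate (elems-sound L))) ,
    trans (length-map edge (elems L)) (elems-length L)
    where
    edge : Fin n → Fin n × Fin n
    edge u = u , f u

    edges : List (Fin n) → Edges
    edges = map edge

    endpoint-⁻ : ∀ us {z} → z ∈ˡ endpoints G (edges us) → z ∈ˡ us ⊎ ∃ λ w → w ∈ˡ us × z ≡ f w
    endpoint-⁻ (u ∷ us) (here refl) = inj₁ (here refl)
    endpoint-⁻ (u ∷ us) (there (here refl)) = inj₂ (u , here refl , refl)
    endpoint-⁻ (u ∷ us) (there (there z∈)) with endpoint-⁻ us z∈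
    ... | inj₁ z∈us = inj₁ (there z∈us)
    ... | inj₂ (w , w∈us , z≡fw) = inj₂ (w , there w∈us , z≡fw)

    unique : ∀ us → Unique us → All (_∈ L) us → Unique (endpoints G (edges us))
    unique [] _ _ = []
    unique (u ∷ us) (u∉us ∷ U) (u∈L ∷ us⊆L) =
      (u≢fu ∷ All.tabulate u∉rest) ∷ All.tabulate fu∉rest ∷ unique us U us⊆L
      where
      in-R : ∀ {z} → z ∈ L → z ∉ R
      in-R = L∩R=∅
      u≢fu : u ≢ f u
      u≢fu u≡fu = in-R u∈L (subst (_∈ R) (sym u≡fu) (proj₁ (into u∈L)))
      u∉rest : ∀ {z} → z ∈ˡ endpoints G (edges us) → u ≢ z
      u∉rest z∈ u≡z with endpoint-⁻ us z∈
      ... | inj₁ z∈us = All.lookup u∉us z∈us u≡z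
      ... | inj₂ (w , w∈us , z≡fw) =
            in-R u∈L (subst (_∈ R) (sym (trans u≡z z≡fw)) (proj₁ (into (All.lookup us⊆L w∈us))))
      fu∉rest : ∀ {z} → z ∈ˡ endpoints G (edges us) → f u ≢ z
      fu∉rest z∈ fu≡z with endpoint-⁻ us z∈
      ... | inj₁ z∈us = in-R (All.lookup us⊆L z∈us) (subst (_∈ R) fu≡z (proj₁ (into u∈L)))
      ... | inj₂ (w , w∈us , z≡fw) =
            All.lookup u∉us w∈us (injective u∈L (All.lookup us⊆L w∈us) (trans fu≡z z≡fw))

  module Matched (M : Edges) (isM : IsMatching G M) where

    V : Subset n
    V = fromList (endpoints G M)

    p : Fin n → Fin n
    p = partner M

    private
      ends-unique : Unique (endpoints G M)
      ends-unique = proj₂ isM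

    ∣V∣ : ∣ V ∣ ≡ length M + length M
    ∣V∣ = trans (∣fromList∣ (endpoints G M) ends-unique) (endpoints-length M)

    p-V : ∀ {x} → x ∈ V → p x ∈ V
    p-V x∈V = fromList-⁺ (endpoints G M) (partner-∈ M ends-unique (fromList-⁻ (endpoints G M) x∈V))

    p-adj : ∀ {x} → x ∈ V → adj G x (p x) ≡ true
    p-adj x∈V = partner-adj M isM (fromList-⁻ (endpoints G M) x∈V)

    p-involutive : ∀ {x} → x ∈ V → p (p x) ≡ x
    p-involutive x∈V = partner-involutive M ends-unique (fromList-⁻ (endpoints G M) x∈V)

    p-injective : ∀ {x y} → x ∈ V → y ∈ V → p x ≡ p y → x ≡ y
    p-injective x∈V y∈V px≡py = trans (sym (p-involutive x∈V)) (trans (cong p px≡py) (p-involutive y∈V))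

    p-leaves : ∀ {A x} → Ind A → x ∈ V → x ∈ A → p x ∉ A
    p-leaves {A} {x} indA x∈V x∈A px∈A with trans (sym (p-adj x∈V)) (indA x (p x) x∈A px∈A)
    ... | ()

    -- Each edge of M has at most one end in an independent set A.
    ∣V∩A∣≤∣V─A∣ : ∀ {A} → Ind A → ∣ V ∩ A ∣ ≤ ∣ V ─ A ∣
    ∣V∩A∣≤∣V─A∣ {A} indA = injection-≤ p (V ∩ A) (V ─ A)
      (λ x∈ → let (x∈V , x∈A) = x∈p∩q⁻ V A x∈ in x∈p∧x∉q⇒x∈p─q (p-V x∈V) (p-leaves indA x∈V x∈A))
      (λ x∈ y∈ → p-injective (p∩q⊆p V A x∈) (p∩q⊆p V A y∈))

    ∣V∩A∣+∣V─A∣ : ∀ A → ∣ V ∩ A ∣ + ∣ V ─ A ∣ ≡ length M + length M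
    ∣V∩A∣+∣V─A∣ A = trans (∣p∩q∣+∣p─q∣≡∣p∣ V A) ∣V∣

    ∣V∩A∣≤∣M∣ : ∀ {A} → Ind A → ∣ V ∩ A ∣ ≤ length M
    ∣V∩A∣≤∣M∣ {A} indA = half-≤ (∣ V ∩ A ∣) (length M)
      (≤-trans (+-monoʳ-≤ ∣ V ∩ A ∣ (∣V∩A∣≤∣V─A∣ indA)) (≤-reflexive (∣V∩A∣+∣V─A∣ A)))

    -- Weak duality μ ≤ n − α: ∣ M ∣ ≤ ∣ V ─ A ∣ ≤ ∣ ∁ A ∣ for independent A.
    matching-≤-∁ : ∀ {A} → Ind A → length M ≤ ∣ ∁ A ∣
    matching-≤-∁ {A} indA = ≤-trans
      (half-≤ (length M) (∣ V ─ A ∣) (≤-trans (≤-reflexive (sym (∣V∩A∣+∣V─A∣ A))) (+-monoˡ-≤ ∣ V ─ A ∣ (∣V∩A∣≤∣V─A∣ indA))))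
      (p⊆q⇒∣p∣≤∣q∣ (λ x∈ → x∉p⇒x∈∁p (x∈p─q⇒x∉q V A x∈)))

    -- For independent I, d(I) ≤ n − ∣ V ∣: the partner injects I ∩ V into N(I).
    ind-difference-bound : ∀ {I} → Ind I → ∣ I ∣ + ∣ V ∣ ≤ ∣ N⟨ I ⟩ ∣ + n
    ind-difference-bound {I} indI = begin
      ∣ I ∣ + ∣ V ∣                         ≡⟨ cong (_+ ∣ V ∣) (∣p∩q∣+∣p─q∣≡∣p∣ I V) ⟨
      (∣ I ∩ V ∣ + ∣ I ─ V ∣) + ∣ V ∣       ≡⟨ +-assoc (∣ I ∩ V ∣) (∣ I ─ V ∣) (∣ V ∣) ⟩
      ∣ I ∩ V ∣ + (∣ I ─ V ∣ + ∣ V ∣)       ≤⟨ +-mono-≤ I∩V≤N (disjoint-≤ (I ─ V) V (x∈p─q⇒x∉q I V)) ⟩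
      ∣ N⟨ I ⟩ ∣ + n                        ∎
      where
      open ≤-Reasoning
      I∩V≤N : ∣ I ∩ V ∣ ≤ ∣ N⟨ I ⟩ ∣
      I∩V≤N = injection-≤ p (I ∩ V) N⟨ I ⟩
        (λ x∈ → let (x∈I , x∈V) = x∈p∩q⁻ I V x∈ in N-⁺ x∈I (adj-flip (p-adj x∈V)))
        (λ x∈ y∈ → p-injective (p∩q⊆q I V x∈) (p∩q⊆q I V y∈))

    module KEPair {S : Subset n} (indS : Ind S) (∣S∣+∣M∣≡n : ∣ S ∣ + length M ≡ n) where

      private
        ∣V∩S∣+∣S─V∣ : ∣ V ∩ S ∣ + ∣ S ─ V ∣ ≡ ∣ S ∣
        ∣V∩S∣+∣S─V∣ = trans (cong (λ P → ∣ P ∣ + ∣ S ─ V ∣) (∩-comm V S)) (∣p∩q∣+∣p─q∣≡∣p∣ S V)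

        ∣S─V∣+∣V∣≤n : ∣ S ─ V ∣ + ∣ V ∣ ≤ n
        ∣S─V∣+∣V∣≤n = disjoint-≤ (S ─ V) V (x∈p─q⇒x∉q S V)

      ∣M∣≤∣V∩S∣ : length M ≤ ∣ V ∩ S ∣
      ∣M∣≤∣V∩S∣ = lower (∣ V ∩ S ∣) (∣ S ─ V ∣) (length M) (begin
        ∣ S ─ V ∣ + (length M + length M)       ≡⟨ cong (∣ S ─ V ∣ +_) ∣V∣ ⟨
        ∣ S ─ V ∣ + ∣ V ∣                       ≤⟨ ∣S─V∣+∣V∣≤n ⟩
        n                                       ≡⟨ trans (cong (_+ length M) ∣V∩S∣+∣S─V∣) ∣S∣+∣M∣≡n ⟨
        (∣ V ∩ S ∣ + ∣ S ─ V ∣) + length M      ∎)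
        where
        open ≤-Reasoning
        lower : ∀ a b l → b + (l + l) ≤ (a + b) + l → l ≤ a
        lower a b l h = +-cancelʳ-≤ l l a (+-cancelˡ-≤ b (l + l) (a + l) (subst (b + (l + l) ≤_) (regroup a b l) h))
          where
          regroup : ∀ a b l → (a + b) + l ≡ b + (a + l)
          regroup = solve-∀

      n≤∣S─V∣+∣V∣ : n ≤ ∣ S ─ V ∣ + ∣ V ∣
      n≤∣S─V∣+∣V∣ = begin
        n                                       ≡⟨ trans (cong (_+ length M) ∣V∩S∣+∣S─V∣) ∣S∣+∣M∣≡n ⟨
        (∣ V ∩ S ∣ + ∣ S ─ V ∣) + length M      ≤⟨ +-monoˡ-≤ (length M) (+-monoˡ-≤ ∣ S ─ V ∣ (∣V∩A∣≤∣M∣ indS)) ⟩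
        (length M + ∣ S ─ V ∣) + length M       ≡⟨ regroup (length M) (∣ S ─ V ∣) ⟩
        ∣ S ─ V ∣ + (length M + length M)       ≡⟨ cong (∣ S ─ V ∣ +_) ∣V∣ ⟨
        ∣ S ─ V ∣ + ∣ V ∣                       ∎
        where
        open ≤-Reasoning
        regroup : ∀ l b → (l + b) + l ≡ b + (l + l)
        regroup = solve-∀

      outside-V : ∀ {x} → x ∉ V → x ∈ S
      outside-V {x} x∉V with x ∈? S
      ... | yes x∈S = x∈S
      ... | no x∉S = ⊥-elim (<⇒≱ (+-monoˡ-< ∣ V ∣ grow) (≤-trans bound n≤∣S─V∣+∣V∣))
        where
        S' = (S ─ V) ∪ ⁅ x ⁆
        grow : ∣ S ─ V ∣ < ∣ S' ∣
        grow = ⊆-∉⇒∣∣< (p⊆p∪q ⁅ x ⁆) (x∈p∪q⁺ (inj₂ (x∈⁅x⁆ x))) (x∉S ∘ p─q⊆p S V)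
        bound : ∣ S' ∣ + ∣ V ∣ ≤ n
        bound = disjoint-≤ S' V λ y∈ y∈V →
          [ (λ y∈S─V → x∈p─q⇒x∉q S V y∈S─V y∈V) , (λ y∈⁅x⁆ → x∉V (subst (_∈ V) (x∈⁅y⁆⇒x≡y x y∈⁅x⁆) y∈V)) ]′
            (x∈p∪q⁻ (S ─ V) ⁅ x ⁆ y∈)

      on-V : ∀ {x} → x ∈ V → x ∈ S ⊎ p x ∈ S
      on-V {x} x∈V with x ∈? S | p x ∈? S
      ... | yes x∈S | _ = inj₁ x∈S
      ... | no _ | yes px∈S = inj₂ px∈S
      ... | no x∉S | no px∉S = ⊥-elim (<⇒≱ (+-mono-≤-< ∣M∣≤∣V∩S∣ ∣V∩S∣<∣V─S∣) (begin
        ∣ V ∩ S ∣ + ∣ V ─ S ∣       ≡⟨ ∣V∩A∣+∣V─A∣ S ⟩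
        length M + length M         ≤⟨ +-monoʳ-≤ (length M) ∣M∣≤∣V∩S∣ ⟩
        length M + ∣ V ∩ S ∣        ∎))
        where
        open ≤-Reasoning
        into : ∀ {y} → y ∈ V ∩ S → p y ∈ (V ─ S) - x
        into y∈ = let (y∈V , y∈S) = x∈p∩q⁻ V S y∈ in
          x∈p∧x≢y⇒x∈p-y (x∈p∧x∉q⇒x∈p─q (p-V y∈V) (p-leaves indS y∈V y∈S))
            (λ py≡x → px∉S (subst (_∈ S) (trans (sym (p-involutive y∈V)) (cong p py≡x)) y∈S))
        ∣V∩S∣<∣V─S∣ : ∣ V ∩ S ∣ < ∣ V ─ S ∣
        ∣V∩S∣<∣V─S∣ = ≤-<-trans
          (injection-≤ p (V ∩ S) ((V ─ S) - x) into (λ y∈ z∈ → p-injective (p∩q⊆p V S y∈) (p∩q⊆p V S z∈)))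
          (x∈p⇒∣p-x∣<∣p∣ (x∈p∧x∉q⇒x∈p─q x∈V x∉S))

    ∣∁V∣+∣M∣≡a : ∀ {a} → a + length M ≡ n → ∣ ∁ V ∣ + length M ≡ a
    ∣∁V∣+∣M∣≡a {a} a+∣M∣≡n = +-cancelʳ-≡ (length M) (∣ ∁ V ∣ + length M) a (begin
      (∣ ∁ V ∣ + length M) + length M   ≡⟨ +-assoc (∣ ∁ V ∣) (length M) (length M) ⟩
      ∣ ∁ V ∣ + (length M + length M)   ≡⟨ cong (∣ ∁ V ∣ +_) ∣V∣ ⟨
      ∣ ∁ V ∣ + ∣ V ∣                   ≡⟨ ∣∁p∣+∣p∣≡n V ⟩
      n                                 ≡⟨ a+∣M∣≡n ⟨
      a + length M                      ∎)
      where open ≡-Reasoning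

    -- A nonempty family Γ of independent sets of size a, where a + ∣ M ∣ = n:
    -- each member forms a KE pair with M, so ⋂Γ and ⋃Γ contain ∁V, and the
    -- partner maps ⋂Γ ∩ V bijectively onto V ─ ⋃Γ.
    module KEFamily {a : ℕ} (a+∣M∣≡n : a + length M ≡ n) (Γ : List (Subset n))
                    (members : All (λ S → Ind S × ∣ S ∣ ≡ a) Γ) where

      private
        member-ind : ∀ {S} → S ∈ˡ Γ → Ind S
        member-ind S∈ = proj₁ (All.lookup members S∈)

        member-ke-pair : ∀ {S} → S ∈ˡ Γ → ∣ S ∣ + length M ≡ n
        member-ke-pair S∈ = trans (cong (_+ length M) (proj₂ (All.lookup members S∈))) a+∣M∣≡n

        outside-V : ∀ {S x} → S ∈ˡ Γ → x ∈ ∁ V → x ∈ S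
        outside-V S∈ x∈∁V = KEPair.outside-V (member-ind S∈) (member-ke-pair S∈) (x∈∁p⇒x∉p x∈∁V)

      ∁V⊆⋂ : ∁ V ⊆ ⋂ Γ
      ∁V⊆⋂ x∈ = ⋂-⁺ Γ λ S∈ → outside-V S∈ x∈

      ∁V⊆⋃ : ∀ {S} → S ∈ˡ Γ → ∁ V ⊆ ⋃ Γ
      ∁V⊆⋃ S∈ x∈ = ⋃-⁺ Γ S∈ (outside-V S∈ x∈)

      -- A vertex of ⋂Γ ∩ V has its partner outside every member; a vertex of
      -- V ─ ⋃Γ has its partner in every member.
      ∣⋂∩V∣≡∣V─⋃∣ : ∣ ⋂ Γ ∩ V ∣ ≡ ∣ V ─ ⋃ Γ ∣
      ∣⋂∩V∣≡∣V─⋃∣ = ≤-antisym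
        (injection-≤ p (⋂ Γ ∩ V) (V ─ ⋃ Γ) to (λ y∈ y'∈ → p-injective (p∩q⊆q (⋂ Γ) V y∈) (p∩q⊆q (⋂ Γ) V y'∈)))
        (injection-≤ p (V ─ ⋃ Γ) (⋂ Γ ∩ V) from (λ z∈ z'∈ → p-injective (p─q⊆p V (⋃ Γ) z∈) (p─q⊆p V (⋃ Γ) z'∈)))
        where
        to : ∀ {y} → y ∈ ⋂ Γ ∩ V → p y ∈ V ─ ⋃ Γ
        to y∈ = let (y∈⋂ , y∈V) = x∈p∩q⁻ (⋂ Γ) V y∈ in x∈p∧x∉q⇒x∈p─q (p-V y∈V) λ py∈⋃ →
          let (S , S∈ , py∈S) = ⋃-⁻ Γ py∈⋃ in p-leaves (member-ind S∈) y∈V (⋂-⁻ Γ y∈⋂ S∈) py∈S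

        from : ∀ {z} → z ∈ V ─ ⋃ Γ → p z ∈ ⋂ Γ ∩ V
        from {z} z∈ = x∈p∩q⁺ (⋂-⁺ Γ partner-in , p-V z∈V)
          where
          z∈V = p─q⊆p V (⋃ Γ) z∈
          partner-in : ∀ {S} → S ∈ˡ Γ → p z ∈ S
          partner-in S∈ = [ (λ z∈S → ⊥-elim (x∈p─q⇒x∉q V (⋃ Γ) z∈ (⋃-⁺ Γ S∈ z∈S))) , (λ pz∈S → pz∈S) ]′
                            (KEPair.on-V (member-ind S∈) (member-ke-pair S∈) z∈V)

    ke-family : ∀ {a} → a + length M ≡ n → (Γ : List⁺ (Subset n)) →
                All (λ S → Ind S × ∣ S ∣ ≡ a) (toList Γ) → ∣ ⋂ (toList Γ) ∣ + ∣ ⋃ (toList Γ) ∣ ≡ 2 * a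
    ke-family {a} a+∣M∣≡n Γ members = begin
      ∣ Y ∣ + ∣ X ∣                                ≡⟨ cong₂ _+_ (∣p∩q∣+∣∁q∣≡∣p∣ Y V ∁V⊆⋂) (∣p∩q∣+∣∁q∣≡∣p∣ X V (∁V⊆⋃ (here refl))) ⟨
      (∣ Y ∩ V ∣ + c) + (∣ X ∩ V ∣ + c)            ≡⟨ cong (λ k → (k + c) + (∣ X ∩ V ∣ + c)) ∣⋂∩V∣≡∣V─⋃∣ ⟩
      (∣ V ─ X ∣ + c) + (∣ X ∩ V ∣ + c)            ≡⟨ regroup (∣ V ─ X ∣) (∣ X ∩ V ∣) c ⟩
      (∣ X ∩ V ∣ + ∣ V ─ X ∣) + (c + c)            ≡⟨ cong (λ P → (∣ P ∣ + ∣ V ─ X ∣) + (c + c)) (∩-comm X V) ⟩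
      (∣ V ∩ X ∣ + ∣ V ─ X ∣) + (c + c)            ≡⟨ cong (_+ (c + c)) (∣V∩A∣+∣V─A∣ X) ⟩
      (length M + length M) + (c + c)              ≡⟨ regroup' (length M) c ⟩
      2 * (c + length M)                           ≡⟨ cong (2 *_) (∣∁V∣+∣M∣≡a a+∣M∣≡n) ⟩
      2 * a                                        ∎
      where
      open ≡-Reasoning
      open KEFamily a+∣M∣≡n (toList Γ) members
      Y = ⋂ (toList Γ)
      X = ⋃ (toList Γ)
      c = ∣ ∁ V ∣
      regroup : ∀ y x c → (y + c) + (x + c) ≡ (x + y) + (c + c)
      regroup = solve-∀
      regroup' : ∀ l c → (l + l) + (c + c) ≡ 2 * (c + l)
      regroup' = solve-∀

  -- (i) ⇒ (ii).  In a KE graph a maximum independent set S₀ is critical, since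
  -- d(I) ≤ n − 2μ = α − μ ≤ d(S₀); hence maximum critical sets have size α.
  ke⇒every-family-KE : IsKE G → ∀ (Γ : List⁺ (Subset n)) → All (IsMaxCritical G) (toList Γ) → IsKECollection G Γ
  ke⇒every-family-KE (a , m , alpha@((S₀ , indS₀ , ∣S₀∣≡a) , a-max) , ((M , isM , ∣M∣≡m) , _) , a+m≡n) Γ maxCritical =
    All.map (proj₁ ∘ proj₁) maxCritical , a , alpha ,
    ke-family a+∣M∣≡n Γ (All.map (λ mc → let indS = proj₁ (proj₁ mc) in indS , size-α indS mc) maxCritical)
    where
    open Matched M isM
    a+∣M∣≡n : a + length M ≡ n
    a+∣M∣≡n = trans (cong (a +_) ∣M∣≡m) a+m≡n

    S₀-critical : Critical S₀
    S₀-critical = indS₀ , λ I indI → subst (λ s → ∣ I ∣ + ∣ N⟨ S₀ ⟩ ∣ ≤ s + ∣ N⟨ I ⟩ ∣) (sym ∣S₀∣≡a)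
      (duality-arith (∣ I ∣) (∣ N⟨ I ⟩ ∣) (∣ N⟨ S₀ ⟩ ∣) a (length M)
        (subst₂ (λ v k → ∣ I ∣ + v ≤ ∣ N⟨ I ⟩ ∣ + k) ∣V∣ (sym a+∣M∣≡n) (ind-difference-bound indI))
        (subst₂ (λ s k → ∣ N⟨ S₀ ⟩ ∣ + s ≤ k) ∣S₀∣≡a (sym a+∣M∣≡n)
          (disjoint-≤ N⟨ S₀ ⟩ S₀ (λ x∈N x∈S₀ → ind-disjoint-N indS₀ x∈S₀ x∈N))))
      where
      duality-arith : ∀ i ni ns a l → i + (l + l) ≤ ni + (a + l) → ns + a ≤ a + l → i + ns ≤ a + ni
      duality-arith i ni ns a l h₁ h₂ = ≤-trans (+-monoʳ-≤ i ns≤l) (≤-trans i+l≤ni+a (≤-reflexive (+-comm ni a)))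
        where
        ns≤l = +-cancelʳ-≤ a ns l (subst (ns + a ≤_) (+-comm a l) h₂)
        i+l≤ni+a = +-cancelʳ-≤ l (i + l) (ni + a) (subst₂ _≤_ (sym (+-assoc i l l)) (sym (+-assoc ni a l)) h₁)

    size-α : ∀ {S} → Ind S → IsMaxCritical G S → ∣ S ∣ ≡ a
    size-α {S} indS mc = ≤-antisym (a-max S indS)
      (subst (_≤ ∣ S ∣) ∣S₀∣≡a (proj₂ (Equivalence.to maxCritical⇔ mc) S₀ S₀-critical))

  -- For a maximum critical A in a family Γ of critical sets, ∣⋂Γ∣ + ∣⋃Γ∣ ≤ 2∣A∣:
  -- ⋃Γ ⊆ A ∪ T with T = N(A) ∩ ⋃Γ, and ∣T∣ ≤ ∣A ∩ N(T)∣ ≤ ∣A ─ ⋂Γ∣.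
  family-bound : ∀ {A} (Γ : List (Subset n)) → MaxCritical A → A ∈ˡ Γ → All Critical Γ →
                 ∣ ⋂ Γ ∣ + ∣ ⋃ Γ ∣ ≤ ∣ A ∣ + ∣ A ∣
  family-bound {A} Γ maxA@(critA , _) A∈Γ critical = begin
    ∣ Y ∣ + ∣ X ∣                       ≤⟨ +-monoʳ-≤ ∣ Y ∣ (p⊆q⇒∣p∣≤∣q∣ X⊆A∪T) ⟩
    ∣ Y ∣ + ∣ A ∪ T ∣                   ≤⟨ +-monoʳ-≤ ∣ Y ∣ (∣p∪q∣≤∣p∣+∣q∣ A T) ⟩
    ∣ Y ∣ + (∣ A ∣ + ∣ T ∣)             ≤⟨ +-monoʳ-≤ ∣ Y ∣ (+-monoʳ-≤ (∣ A ∣) ∣T∣≤∣A─Y∣) ⟩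
    ∣ Y ∣ + (∣ A ∣ + ∣ A ─ Y ∣)         ≡⟨ +-exchange (∣ Y ∣) (∣ A ∣) (∣ A ─ Y ∣) ⟩
    ∣ A ∣ + (∣ Y ∣ + ∣ A ─ Y ∣)         ≡⟨ cong (λ P → ∣ A ∣ + (∣ P ∣ + ∣ A ─ Y ∣)) A∩Y≡Y ⟨
    ∣ A ∣ + (∣ A ∩ Y ∣ + ∣ A ─ Y ∣)     ≡⟨ cong (∣ A ∣ +_) (∣p∩q∣+∣p─q∣≡∣p∣ A Y) ⟩
    ∣ A ∣ + ∣ A ∣                       ∎
    where
    open ≤-Reasoning
    Y = ⋂ Γ
    X = ⋃ Γ
    T = N⟨ A ⟩ ∩ X
    X⊆A∪T : X ⊆ A ∪ T
    X⊆A∪T x∈X with ⋃-⁻ Γ x∈X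
    ... | S , S∈ , x∈S with x∈p∪q⁻ A N⟨ A ⟩ (critical-⊆-∪N maxA (All.lookup critical S∈) x∈S)
    ... | inj₁ x∈A = x∈p∪q⁺ (inj₁ x∈A)
    ... | inj₂ x∈N = x∈p∪q⁺ (inj₂ (x∈p∩q⁺ (x∈N , x∈X)))
    A∩N⟨T⟩⊆A─Y : A ∩ N⟨ T ⟩ ⊆ A ─ Y
    A∩N⟨T⟩⊆A─Y {v} v∈ with x∈p∩q⁻ A N⟨ T ⟩ v∈
    ... | v∈A , v∈N with N-⁻ v∈N
    ... | t , t∈T , vt with ⋃-⁻ Γ (p∩q⊆q N⟨ A ⟩ X t∈T)
    ... | S , S∈ , t∈S = x∈p∧x∉q⇒x∈p─q v∈A λ v∈Y →
          ind-disjoint-N (proj₁ (All.lookup critical S∈)) t∈S (N-⁺ (⋂-⁻ Γ v∈Y S∈) (adj-flip vt))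
    ∣T∣≤∣A─Y∣ : ∣ T ∣ ≤ ∣ A ─ Y ∣
    ∣T∣≤∣A─Y∣ = ≤-trans (critical-hall critA (p∩q⊆p N⟨ A ⟩ X)) (p⊆q⇒∣p∣≤∣q∣ A∩N⟨T⟩⊆A─Y)
    A∩Y≡Y : A ∩ Y ≡ Y
    A∩Y≡Y = ⊆-antisym (p∩q⊆q A Y) (λ x∈Y → x∈p∩q⁺ (⋂-⁻ Γ x∈Y A∈Γ , x∈Y))

  -- A critical set of size α makes G König–Egerváry: N(A) is the complement of
  -- A, Hall's theorem (via Larson's lemma) matches N(A) into A, and no matching
  -- exceeds ∣∁A∣.
  critical-maximum⇒KE : ∀ {A a} → Critical A → IsAlpha G a → ∣ A ∣ ≡ a → IsKE G
  critical-maximum⇒KE {A} {a} critA@(indA , _) alpha@(_ , a-max) ∣A∣≡a =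
    a , ∣ ∁ A ∣ , alpha , ((M , isM , trans ∣M∣≡∣N⟨A⟩∣ ∣N⟨A⟩∣≡∣∁A∣) , λ M' isM' → Matched.matching-≤-∁ M' isM' indA) ,
    trans (cong₂ _+_ (sym ∣A∣≡a) refl) (trans (+-comm (∣ A ∣) (∣ ∁ A ∣)) (∣∁p∣+∣p∣≡n A))
    where
    N⟨A⟩∩A=∅ : Disjoint N⟨ A ⟩ A
    N⟨A⟩∩A=∅ x∈N x∈A = ind-disjoint-N indA x∈A x∈N

    ∁A⊆N⟨A⟩ : ∁ A ⊆ N⟨ A ⟩
    ∁A⊆N⟨A⟩ {v} v∈∁A with v ∈? N⟨ A ⟩
    ... | yes v∈N = v∈N
    ... | no v∉N = ⊥-elim (<⇒≱ ∣A∣<∣A∪v∣ (subst (∣ A ∪ ⁅ v ⁆ ∣ ≤_) (sym ∣A∣≡a) (a-max (A ∪ ⁅ v ⁆) ind-A∪v)))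
      where
      ind-A∪v : Ind (A ∪ ⁅ v ⁆)
      ind-A∪v = ind-∪ indA (ind-⁅⁆ v) (no-edge-outside-N λ w∈ → subst (_∉ N⟨ A ⟩) (sym (x∈⁅y⁆⇒x≡y v w∈)) v∉N)
      ∣A∣<∣A∪v∣ : ∣ A ∣ < ∣ A ∪ ⁅ v ⁆ ∣
      ∣A∣<∣A∪v∣ = ⊆-∉⇒∣∣< (p⊆p∪q ⁅ v ⁆) (x∈p∪q⁺ (inj₂ (x∈⁅x⁆ v))) (x∈∁p⇒x∉p v∈∁A)

    ∣N⟨A⟩∣≡∣∁A∣ : ∣ N⟨ A ⟩ ∣ ≡ ∣ ∁ A ∣
    ∣N⟨A⟩∣≡∣∁A∣ = ⊆-antisym-∣∣ (λ x∈N → x∉p⇒x∈∁p (N⟨A⟩∩A=∅ x∈N)) ∁A⊆N⟨A⟩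

    matching = saturating⇒matching N⟨A⟩∩A=∅ (hall (∣ N⟨ A ⟩ ∣) N⟨ A ⟩ A ≤-refl (λ T T⊆N → critical-hall critA T⊆N))
    M = proj₁ matching
    isM = proj₁ (proj₂ matching)
    ∣M∣≡∣N⟨A⟩∣ = proj₂ (proj₂ matching)

  -- (iii) ⇒ (i).  If Γ is a KE collection of maximum critical sets and A ∈ Γ,
  -- then 2α = ∣⋂Γ∣ + ∣⋃Γ∣ ≤ 2∣A∣, so A is a critical set of size α.
  ke-collection⇒KE : ∀ (Γ : List⁺ (Subset n)) → All (IsMaxCritical G) (toList Γ) → IsKECollection G Γ → IsKE G
  ke-collection⇒KE Γ@(A ∷⁺ _) maxCritical (_ , a , alpha , ∣⋂∣+∣⋃∣≡2a) =
    critical-maximum⇒KE (proj₁ maxA) alpha (≤-antisym (proj₂ alpha A indA) (half-≤ a (∣ A ∣) 2a≤2∣A∣))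
    where
    maxCritical' = All.map (Equivalence.to maxCritical⇔) maxCritical
    maxA = All.lookup maxCritical' (here refl)
    indA = proj₁ (proj₁ maxA)
    2a≤2∣A∣ : a + a ≤ ∣ A ∣ + ∣ A ∣
    2a≤2∣A∣ = subst (_≤ ∣ A ∣ + ∣ A ∣) (trans ∣⋂∣+∣⋃∣≡2a (cong (a +_) (+-identityʳ a)))
                (family-bound (toList Γ) maxA (here refl) (All.map proj₁ maxCritical'))

-- Theorem 2.5.  (i) ⇔ (ii) and (i) ⇔ (iii); the family used for (ii) ⇒ (i)
-- and (i) ⇒ (iii) is the singleton of a maximum critical set.
theorem2p5 : ∀ {n : ℕ} (G : Graph n) →
    (IsKE G ⇔ (∀ (Γ : List⁺ (Subset n)) → All (IsMaxCritical G) (toList Γ) → IsKECollection G Γ))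
    × (IsKE G ⇔ Σ (List⁺ (Subset n)) (λ Γ → All (IsMaxCritical G) (toList Γ) × IsKECollection G Γ))
theorem2p5 G =
  mk⇔ (ke⇒every-family-KE G) (λ every → ke-collection⇒KE G Γ₀ Γ₀-maxCritical (every Γ₀ Γ₀-maxCritical)) ,
  mk⇔ (λ ke → Γ₀ , Γ₀-maxCritical , ke⇒every-family-KE G ke Γ₀ Γ₀-maxCritical)
      (λ (Γ , maxCritical , keΓ) → ke-collection⇒KE G Γ maxCritical keΓ)
  where
  A₀ = proj₁ (maxCritical-exists G)
  Γ₀ = A₀ ∷⁺ []
  Γ₀-maxCritical : All (IsMaxCritical G) (toList Γ₀)
  Γ₀-maxCritical = Equivalence.from (maxCritical⇔ G) (proj₂ (maxCritical-exists G)) ∷ []
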